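{- Let $g\ge1$ and ${\underline{n}}=(n_1,\dots,n_g),\ {\underline{r}}=(r_1,\dots,r_g)\in\mathbb{N}_0^g$. Then the modified skew Hall--Littlewood--Schubert series satisfies \[ \operatorname{HLS}'_{{\underline{n}},{\underline{r}}}(\mathbf{Y}^{ -1};\mathbf{X}^{ -1})=(-1)^{N-1}K(\mathbf{Y})^{ -1}\cdot\operatorname{HLS}'_{{\underline{n}},{\underline{r}}}(\mathbf{Y};\mathbf{X}), \] where $N=\sum_{i=1}^g(n_i+r_i)$ and $K(\mathbf{Y})=\prod_{i=1}^{g}\Big(Y_{i,0}^{\binom{r_i}{2}}\prod_{j=1}^{n_i}Y_{i,j}^{\,r_i+j-1}\Big)$, and $\mathbf{Y}^{ -1},\mathbf{X}^{ -1}$ denote replacing every variable by its inverse.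
   Context: $\mathbb{N}_0$ is the set of non-negative integers. For a variable $Y$ and integers $0\le k\le n$, $\binom{n}{k}_Y=\prod_{i=1}^{k}\frac{1-Y^{n-k+i}}{1-Y^i}\in\mathbb{Z}[Y]$; set it to $0$ if $k>n$. For $n,r\in\mathbb{N}_0$, $P_{n,r}$ is the set of tuples $a=(a_0,\dots,a_n)$ of non-negative integers with $a_0\le r$ and $a_i\le1$ for $1\le i\le n$, ordered by $a\le_t b$ iff $\sum_{j=0}^i a_j\le\sum_{j=0}^i b_j$ for all $0\le i\le n$. Set $s_0(a)=\binom{a_0}{2}$, $s_i(a)=\sum_{k=0}^{i-1}a_k$ ($1\le i\le n+1$), $\Delta_i(a,b)=s_i(b)-s_i(a)$. Define $\theta_{a,b}(Y_0)=\binom{b_0}{a_0}_{Y_0}$ and $\phi_{a,b}(Y_1,\dots,Y_n)=\prod_{i\in L_{a,b}}(1-Y_i^{\Delta_i(a,b)})$ if $a\le_t b$, and $0$ otherwise, where $L_{a,b}=\{i\in\{1,\dots,n\}:a_i=1,b_i=0\}$. $P_{{\underline{n}},{\underline{r}}}=P_{n_1,r_1}\times\cdots\times P_{n_g,r_g}$ with the product order; $\hat0$ is the all-zero element and $\hat1$ has $i$-th component $(r_i,1,\dots,1)$. Variables: $\mathbf{Y}=(Y_{i,j})_{i\in[g],0\le j\le n_i}$, $\mathbf{X}=(X_c)_{c\in P_{{\underline{n}},{\underline{r}}}}$. For $a=(a^{(i)})_i,b=(b^{(i)})_i$, $w_{a,b}(\mathbf{Y})=\prod_{i=1}^g\theta_{a^{(i)},b^{(i)}}(Y_{i,0})\phi_{a^{(i)},b^{(i)}}(Y_{i,1},\dots,Y_{i,n_i})$.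 For a chain $C:c_1\le_t\cdots\le_t c_k$, with $c_0=\hat0$, $c_{k+1}=\hat1$, $W_C(\mathbf{Y})=\prod_{j=0}^k w_{c_j,c_{j+1}}(\mathbf{Y})$. The modified series is $\operatorname{HLS}'_{{\underline{n}},{\underline{r}}}(\mathbf{Y};\mathbf{X})=\sum_C W_C(\mathbf{Y})\prod_{c\in C}\frac{X_c}{1-X_c}$, summed over all strict chains $C$ (including the empty chain) in the open interval $(\hat0,\hat1)=\{c:\hat0<_t c<_t\hat1\}$. -}

module Defs where

open import Level using (Level)
open import Data.Bool using (Bool; true; false; _∧_; not; if_then_else_)
open import Data.Nat as ℕ using (ℕ; zero; suc; _∸_; _≤ᵇ_)
open import Data.Nat.Combinatorics using (_C_)
open import Data.Fin using (Fin)
open import Data.List as List using (List; []; _∷_; map; concatMap; filter; upTo; replicate; length; foldr)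
open import Data.Vec as Vec using (Vec; []; _∷_; lookup)
import Data.Vec.Properties as VecP
import Data.List.Properties as ListP
open import Relation.Nullary.Decidable using (does)
open import Algebra.Bundles using (CommutativeRing)

-- Elements of P_{n,r} are encoded as lists (a_0 ∷ a_1 ∷ … ∷ a_n) of
-- naturals; elements of the product poset P_{n,r} (n, r ∈ ℕ^g) as
-- vectors of such lists.

bits : ℕ → List (List ℕ)
bits zero    = [] ∷ []
bits (suc n) = concatMap (λ b → map (b ∷_) (bits n)) (0 ∷ 1 ∷ [])

elemsP : ℕ → ℕ → List (List ℕ)
elemsP n r = concatMap (λ a0 → map (a0 ∷_) (bits n)) (upTo (suc r))

allP : ∀ {g} → Vec ℕ g → Vec ℕ g → List (Vec (List ℕ) g)
allP []       []       = [] ∷ []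
allP (n ∷ ns) (r ∷ rs) =
  concatMap (λ a → map (a ∷_) (allP ns rs)) (elemsP n r)

bot : ∀ {g} → Vec ℕ g → Vec (List ℕ) g
bot []       = []
bot (n ∷ ns) = (0 ∷ replicate n 0) ∷ bot ns

top : ∀ {g} → Vec ℕ g → Vec ℕ g → Vec (List ℕ) g
top []       []       = []
top (n ∷ ns) (r ∷ rs) = (r ∷ replicate n 1) ∷ top ns rs

leqTGo : ℕ → ℕ → List ℕ → List ℕ → Bool
leqTGo sa sb []       []       = true
leqTGo sa sb (a ∷ as) (b ∷ bs) =
  ((sa ℕ.+ a) ≤ᵇ (sb ℕ.+ b)) ∧ leqTGo (sa ℕ.+ a) (sb ℕ.+ b) as bs
leqTGo sa sb _        _        = false

leqT : List ℕ → List ℕ → Bool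
leqT = leqTGo 0 0

leqP : ∀ {g} → Vec (List ℕ) g → Vec (List ℕ) g → Bool
leqP []       []       = true
leqP (a ∷ as) (b ∷ bs) = leqT a b ∧ leqP as bs

eqP : ∀ {g} → Vec (List ℕ) g → Vec (List ℕ) g → Bool
eqP a b = does (VecP.≡-dec (ListP.≡-dec ℕ._≟_) a b)

ltP : ∀ {g} → Vec (List ℕ) g → Vec (List ℕ) g → Bool
ltP a b = leqP a b ∧ not (eqP a b)

inOpen : ∀ {g} → Vec ℕ g → Vec ℕ g → Vec (List ℕ) g → Bool
inOpen ns rs c = ltP (bot ns) c ∧ ltP c (top ns rs)

chainsAbove : ∀ {g} → Vec ℕ g → Vec ℕ g → ℕ → Vec (List ℕ) g
            → List (List (Vec (List ℕ) g))
chainsAbove ns rs zero       prev = [] ∷ []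
chainsAbove ns rs (suc fuel) prev =
  [] ∷ concatMap (λ c → map (c ∷_) (chainsAbove ns rs fuel c))
                 (List.filterᵇ (λ c → ltP prev c ∧ ltP c (top ns rs)) (allP ns rs))

-- all strict chains in the open interval (0̂,1̂), each listed exactly
-- once.  A strict chain consists of distinct elements of P, hence has
-- length ≤ |P|, so the fuel |P| loses no chain.
chains : ∀ {g} → Vec ℕ g → Vec ℕ g → List (List (Vec (List ℕ) g))
chains ns rs = chainsAbove ns rs (length (allP ns rs)) (bot ns)

bigN : ∀ {g} → Vec ℕ g → Vec ℕ g → ℕ
bigN []       []       = 0
bigN (n ∷ ns) (r ∷ rs) = n ℕ.+ r ℕ.+ bigN ns rs

module Eval {c ℓ : Level} (R : CommutativeRing c ℓ) where
  open CommutativeRing R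

  pow : Carrier → ℕ → Carrier
  pow x zero    = 1#
  pow x (suc k) = x * pow x k

  -- Gaussian binomial (n choose k)_Y evaluated at Y = y, via the
  -- q-Pascal rule; it is 0 for k > n.
  gauss : Carrier → ℕ → ℕ → Carrier
  gauss y n       zero    = 1#
  gauss y zero    (suc k) = 0#
  gauss y (suc n) (suc k) = gauss y n k + pow y (suc k) * gauss y n (suc k)

  theta : Carrier → List ℕ → List ℕ → Carrier
  theta y (a0 ∷ _) (b0 ∷ _) = gauss y b0 a0
  theta y _        _        = 1#

  -- ∏_{i ∈ L_{a,b}} (1 - Y_i^{Δ_i(a,b)}); position i, running sums
  -- sa = s_i(a), sb = s_i(b)
  phiGo : (ℕ → Carrier) → ℕ → ℕ → ℕ → List ℕ → List ℕ → Carrier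
  phiGo y i sa sb (ai ∷ as) (bi ∷ bs) =
    (if (ai ℕ.≡ᵇ 1) ∧ (bi ℕ.≡ᵇ 0)
       then 1# + - pow (y i) (sb ∸ sa)
       else 1#)
    * phiGo y (suc i) (sa ℕ.+ ai) (sb ℕ.+ bi) as bs
  phiGo y i sa sb _ _ = 1#

  phi : (ℕ → Carrier) → List ℕ → List ℕ → Carrier
  phi y a b with leqT a b
  ... | false = 0#
  phi y (a0 ∷ as) (b0 ∷ bs) | true = phiGo y 1 a0 b0 as bs
  phi y _         _         | true = 1#

  w : ∀ {g} → (Fin g → ℕ → Carrier) → Vec (List ℕ) g → Vec (List ℕ) g → Carrier
  w {g} y a b = go (Vec.allFin g) a b
    where
    go : ∀ {m} → Vec (Fin g) m → Vec (List ℕ) m → Vec (List ℕ) m → Carrier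
    go []       []       []       = 1#
    go (i ∷ is) (a ∷ as) (b ∷ bs) =
      theta (y i 0) a b * phi (y i) a b * go is as bs

  -- W_C(Y) ∏_{c ∈ C} q_c  for the chain C = (c_1,…,c_k), c_0 = prev,
  -- c_{k+1} = one
  chainTerm : ∀ {g} → (Fin g → ℕ → Carrier) → (Vec (List ℕ) g → Carrier)
            → Vec (List ℕ) g → Vec (List ℕ) g → List (Vec (List ℕ) g) → Carrier
  chainTerm y q one prev []       = w y prev one
  chainTerm y q one prev (c ∷ cs) = w y prev c * q c * chainTerm y q one c cs

  -- HLS'_{n,r}(Y;X) evaluated at Y = y, where q c is the value of
  -- X_c/(1 - X_c)
  HLS : ∀ {g} → Vec ℕ g → Vec ℕ g → (Fin g → ℕ → Carrier)
      → (Vec (List ℕ) g → Carrier) → Carrier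
  HLS ns rs y q =
    foldr _+_ 0# (map (chainTerm y q (top ns rs) (bot ns)) (chains ns rs))

  K : ∀ {g} → Vec ℕ g → Vec ℕ g → (Fin g → ℕ → Carrier) → Carrier
  K {g} ns rs y = go (Vec.allFin g) ns rs
    where
    inner : Fin g → ℕ → List ℕ → Carrier
    inner i r js = foldr _*_ 1# (map (λ j → pow (y i j) (r ℕ.+ j ∸ 1)) js)
    go : ∀ {m} → Vec (Fin g) m → Vec ℕ m → Vec ℕ m → Carrier
    go []       []       []       = 1#
    go (i ∷ is) (n ∷ ns) (r ∷ rs) =
      pow (y i 0) (r C 2) * inner i r (List.applyUpTo suc n) * go is ns rs

  -- (-1)^{N-1}  (natural-number subtraction)
  sign : ℕ → Carrier
  sign N = pow (- 1#) (N ∸ 1)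

{-# OPTIONS --safe #-}
module Submission where

-- Write q = X/(1 - X) for the mark of a chain element.  Inverting X turns q
-- into -(1 + q), and inverting Y turns the weights w into w′ = w(Y⁻¹).  The
-- weights admit a Möbius-type function μ, on each component
-- (-1)^{|c|} Y₀^{binom(c₀,2)} ∏_j Y_j^{s_j(c)}, with
--   Σ_c w′(a,c) μ(c) w(c,b) = δ_{ab} μ(b);
-- on a component this is proved by peeling off the last coordinate, the first
-- coordinate being the inversion formula for Gaussian binomials.  Restricted to
-- an open interval it reads Σ_{p<c<b} w′(p,c) μ(c) w(c,b) = -μ(p) w(p,b) - w′(p,b) μ(b).
-- For S(p), the sum over the chains from p to 1̂, this turns the recursion for
-- S′(p) into S′(p) = -U μ(p) S(p), where U = (-1)^N K(Y⁻¹) is the inverse of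
-- μ(1̂); at p = 0̂ one has μ(0̂) = 1.

open import Defs
open import Level using (Level; 0ℓ)
open import Algebra.Bundles using (CommutativeRing; RawRing)
open import Data.Bool using (Bool; true; false; _∧_; not; T; if_then_else_)
import Data.Bool.Properties as Boolₚ
open import Data.Empty using (⊥-elim)
open import Data.Fin as Fin using (Fin)
open import Data.List
  using (List; []; _∷_; _∷ʳ_; _++_; length; map; concatMap; foldr; filterᵇ; upTo; applyUpTo; replicate)
import Data.List.Properties as Listₚ
open import Data.List.Membership.Propositional using (_∈_; find)
open import Data.List.Membership.Propositional.Properties
  using (∈-concatMap⁻; ∈-concatMap⁺; ∈-map⁻; ∈-map⁺; ∈-upTo⁻; ∈-upTo⁺; ∈-filter⁺)
import Data.List.Relation.Unary.Any as Any
open import Data.List.Relation.Unary.Any using (here; there)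
open import Data.Nat as ℕ using (ℕ; zero; suc; _≤_; _<_; z≤n; s≤s; _≤ᵇ_; _≡ᵇ_; _∸_)
import Data.Nat.Properties as ℕₚ
open import Data.Nat.Combinatorics using (_C_; nC1≡n; nCk+nC[k+1]≡[n+1]C[k+1])
open import Data.Nat.ListAction using (sum)
open import Data.Nat.ListAction.Properties using (sum-++)
open import Data.Product using (_×_; _,_; proj₁; proj₂)
import Data.Product.Properties as Productₚ
open import Data.Sum using (inj₁; inj₂)
open import Data.Vec using (Vec; []; _∷_; lookup; tabulate)
import Data.Vec.Properties as Vecₚ
open import Relation.Binary.Definitions using (tri<; tri≈; tri>)
open import Relation.Binary.PropositionalEquality as ≡ using (_≡_; _≢_)
open import Relation.Nullary using (¬_; Dec; yes; no; does)
open import Relation.Nullary.Decidable using (dec-true; dec-false; T?)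
open import Function using (id; _∘_)

module IntegerRingSolver {c ℓ} (R : CommutativeRing c ℓ) where

  open CommutativeRing R
  open import Algebra.Properties.Ring ring
    using (-0#≈0#; -‿+-comm; -‿involutive; -‿distribˡ-*; -‿distribʳ-*; ⁻¹-anti-homo‿-)
  open import Algebra.Properties.Semiring.Mult.TCOptimised semiring renaming (_×_ to _×ᴿ_)
    using (1+×; ×-homo-+; ×1-homo-*)
  open import Algebra.Solver.Ring.AlmostCommutativeRing
    using (fromCommutativeRing; _-Raw-AlmostCommutative⟶_; Induced-equivalence)
  open import Relation.Binary.Definitions using (WeaklyDecidable)
  open import Relation.Binary.Consequences using (dec⇒weaklyDec)
  import Data.Maybe as Maybe
  open import Relation.Binary.Reasoning.Setoid setoid

  -- Integer coefficients as pairs (p , n) standing for p − n, kept normalised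
  -- (one entry is 0) so that equality of coefficients is syntactic equality.
  normalise : ℕ → ℕ → ℕ × ℕ
  normalise p n = p ∸ n , n ∸ p

  differences : RawRing 0ℓ 0ℓ
  differences = record
    { Carrier = ℕ × ℕ
    ; _≈_     = _≡_
    ; _+_     = λ (p , n) (p′ , n′) → normalise (p ℕ.+ p′) (n ℕ.+ n′)
    ; _*_     = λ (p , n) (p′ , n′) → normalise (p ℕ.* p′ ℕ.+ n ℕ.* n′) (p ℕ.* n′ ℕ.+ n ℕ.* p′)
    ; -_      = λ (p , n) → n , p
    ; 0#      = 0 , 0
    ; 1#      = 1 , 0
    }

  fromℕ : ℕ → Carrier
  fromℕ n = n ×ᴿ 1#

  -- Defined so that the constants 0 and 1 denote 0# and 1# definitionally.
  ⟦_⟧ : ℕ × ℕ → Carrier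
  ⟦ p , zero ⟧  = fromℕ p
  ⟦ p , suc n ⟧ = fromℕ p + - fromℕ (suc n)

  +-minus-+ : ∀ a b c d → (a + b) + - (c + d) ≈ (a + - c) + (b + - d)
  +-minus-+ a b c d = begin
    (a + b) + - (c + d)       ≈⟨ +-congˡ (-‿+-comm c d) ⟨
    (a + b) + (- c + - d)     ≈⟨ +-assoc a b _ ⟩
    a + (b + (- c + - d))     ≈⟨ +-congˡ (+-assoc b (- c) (- d)) ⟨
    a + ((b + - c) + - d)     ≈⟨ +-congˡ (+-congʳ (+-comm b (- c))) ⟩
    a + ((- c + b) + - d)     ≈⟨ +-congˡ (+-assoc (- c) b (- d)) ⟩
    a + (- c + (b + - d))     ≈⟨ +-assoc a (- c) _ ⟨
    (a + - c) + (b + - d)     ∎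

  minus-*-minus : ∀ a b c d → (a + - b) * (c + - d) ≈ (a * c + b * d) + - (a * d + b * c)
  minus-*-minus a b c d = begin
    (a + - b) * (c + - d)                           ≈⟨ distribʳ (c + - d) a (- b) ⟩
    a * (c + - d) + - b * (c + - d)                 ≈⟨ +-cong (distribˡ a c (- d)) (distribˡ (- b) c (- d)) ⟩
    (a * c + a * - d) + (- b * c + - b * - d)       ≈⟨ +-cong (+-congˡ (-‿distribʳ-* a d)) (+-cong (-‿distribˡ-* b c) -b*-d) ⟨
    (a * c + - (a * d)) + (- (b * c) + b * d)       ≈⟨ +-congˡ (+-comm (- (b * c)) (b * d)) ⟩
    (a * c + - (a * d)) + (b * d + - (b * c))       ≈⟨ +-minus-+ (a * c) (b * d) (a * d) (b * c) ⟨
    (a * c + b * d) + - (a * d + b * c)             ∎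
    where
    -b*-d : b * d ≈ - b * - d
    -b*-d = trans (sym (-‿involutive (b * d)))
                  (trans (-‿cong (-‿distribʳ-* b d)) (-‿distribˡ-* b (- d)))

  ⟦⟧-difference : ∀ p n → ⟦ p , n ⟧ ≈ fromℕ p + - fromℕ n
  ⟦⟧-difference p zero    = sym (trans (+-congˡ -0#≈0#) (+-identityʳ _))
  ⟦⟧-difference p (suc n) = refl

  normalise-difference : ∀ p n → fromℕ (p ∸ n) + - fromℕ (n ∸ p) ≈ fromℕ p + - fromℕ n
  normalise-difference zero    zero    = refl
  normalise-difference zero    (suc n) = refl
  normalise-difference (suc p) zero    = refl
  normalise-difference (suc p) (suc n) = begin
    fromℕ (p ∸ n) + - fromℕ (n ∸ p)             ≈⟨ normalise-difference p n ⟩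
    fromℕ p + - fromℕ n                         ≈⟨ +-identityˡ _ ⟨
    0# + (fromℕ p + - fromℕ n)                  ≈⟨ +-congʳ (-‿inverseʳ 1#) ⟨
    (1# + - 1#) + (fromℕ p + - fromℕ n)         ≈⟨ +-minus-+ 1# (fromℕ p) 1# (fromℕ n) ⟨
    (1# + fromℕ p) + - (1# + fromℕ n)           ≈⟨ +-cong (1+× p 1#) (-‿cong (1+× n 1#)) ⟨
    fromℕ (suc p) + - fromℕ (suc n)             ∎

  ⟦normalise⟧ : ∀ p n → ⟦ normalise p n ⟧ ≈ fromℕ p + - fromℕ n
  ⟦normalise⟧ p n = trans (⟦⟧-difference (p ∸ n) (n ∸ p)) (normalise-difference p n)

  morphism : differences -Raw-AlmostCommutative⟶ fromCommutativeRing R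
  morphism = record
    { ⟦_⟧    = ⟦_⟧
    ; +-homo = λ (p , n) (p′ , n′) → begin
        ⟦ normalise (p ℕ.+ p′) (n ℕ.+ n′) ⟧                   ≈⟨ ⟦normalise⟧ (p ℕ.+ p′) (n ℕ.+ n′) ⟩
        fromℕ (p ℕ.+ p′) + - fromℕ (n ℕ.+ n′)                 ≈⟨ +-cong (×-homo-+ 1# p p′) (-‿cong (×-homo-+ 1# n n′)) ⟩
        (fromℕ p + fromℕ p′) + - (fromℕ n + fromℕ n′) ≈⟨ +-minus-+ _ _ _ _ ⟩
        (fromℕ p + - fromℕ n) + (fromℕ p′ + - fromℕ n′)       ≈⟨ +-cong (⟦⟧-difference p n) (⟦⟧-difference p′ n′) ⟨
        ⟦ p , n ⟧ + ⟦ p′ , n′ ⟧                                ∎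
    ; *-homo = λ (p , n) (p′ , n′) → begin
        ⟦ normalise (p ℕ.* p′ ℕ.+ n ℕ.* n′) (p ℕ.* n′ ℕ.+ n ℕ.* p′) ⟧
          ≈⟨ ⟦normalise⟧ (p ℕ.* p′ ℕ.+ n ℕ.* n′) (p ℕ.* n′ ℕ.+ n ℕ.* p′) ⟩
        fromℕ (p ℕ.* p′ ℕ.+ n ℕ.* n′) + - fromℕ (p ℕ.* n′ ℕ.+ n ℕ.* p′)
          ≈⟨ +-cong (fromℕ-homo-+-* p p′ n n′) (-‿cong (fromℕ-homo-+-* p n′ n p′)) ⟩
        (fromℕ p * fromℕ p′ + fromℕ n * fromℕ n′) + - (fromℕ p * fromℕ n′ + fromℕ n * fromℕ p′)
          ≈⟨ minus-*-minus _ _ _ _ ⟨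
        (fromℕ p + - fromℕ n) * (fromℕ p′ + - fromℕ n′)
          ≈⟨ *-cong (⟦⟧-difference p n) (⟦⟧-difference p′ n′) ⟨
        ⟦ p , n ⟧ * ⟦ p′ , n′ ⟧
          ∎
    ; -‿homo = λ (p , n) → begin
        ⟦ n , p ⟧                ≈⟨ ⟦⟧-difference n p ⟩
        fromℕ n + - fromℕ p      ≈⟨ ⁻¹-anti-homo‿- (fromℕ p) (fromℕ n) ⟨
        - (fromℕ p + - fromℕ n)  ≈⟨ -‿cong (⟦⟧-difference p n) ⟨
        - ⟦ p , n ⟧              ∎
    ; 0-homo = refl
    ; 1-homo = refl
    }
    where
    fromℕ-homo-+-* : ∀ a b c d → fromℕ (a ℕ.* b ℕ.+ c ℕ.* d) ≈ fromℕ a * fromℕ b + fromℕ c * fromℕ d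
    fromℕ-homo-+-* a b c d = trans (×-homo-+ 1# (a ℕ.* b) (c ℕ.* d)) (+-cong (×1-homo-* a b) (×1-homo-* c d))

  private
    coefficient≟ : WeaklyDecidable (Induced-equivalence morphism)
    coefficient≟ x y =
      Maybe.map (λ { ≡.refl → refl }) (dec⇒weaklyDec (Productₚ.≡-dec ℕₚ._≟_ ℕₚ._≟_) x y)

  open import Algebra.Solver.Ring differences (fromCommutativeRing R) morphism coefficient≟ public
    using (Polynomial; solve; _:=_; _:+_; _:*_; :-_; _:-_; con)

  𝟘 𝟙 : ∀ {n} → Polynomial n
  𝟘 = con (0 , 0)
  𝟙 = con (1 , 0)

-- The order of P_{n,r} and its enumeration

T⇒≡true : ∀ {b} → T b → b ≡ true
T⇒≡true {true} _ = ≡.refl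

∧-trueˡ : ∀ {a b} → (a ∧ b) ≡ true → a ≡ true
∧-trueˡ {true} _ = ≡.refl

∧-trueʳ : ∀ {a b} → (a ∧ b) ≡ true → b ≡ true
∧-trueʳ {true} e = e

∧-true : ∀ {a b} → a ≡ true → b ≡ true → (a ∧ b) ≡ true
∧-true ≡.refl ≡.refl = ≡.refl

∧-chain : ∀ a b c d e → (a ≡ true → c ≡ true → e ≡ true) → (c ≡ true → d ≡ true → b ≡ true) →
  (a ∧ b) ∧ (c ∧ d) ≡ (e ∧ d) ∧ (a ∧ c)
∧-chain false b c     d     e _ _ = ≡.sym (Boolₚ.∧-zeroʳ (e ∧ d))
∧-chain true  b false d     e _ _ rewrite Boolₚ.∧-zeroʳ b = ≡.sym (Boolₚ.∧-zeroʳ (e ∧ d))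
∧-chain true  b true  false e _ _ rewrite Boolₚ.∧-zeroʳ b | Boolₚ.∧-zeroʳ e = ≡.refl
∧-chain true  b true  true  e a∧c⇒e c∧d⇒b rewrite a∧c⇒e ≡.refl ≡.refl | c∧d⇒b ≡.refl ≡.refl = ≡.refl

≤⇒≤ᵇ : ∀ {m n} → m ≤ n → (m ≤ᵇ n) ≡ true
≤⇒≤ᵇ m≤n = T⇒≡true (ℕₚ.≤⇒≤ᵇ m≤n)

≤ᵇ⇒≤ : ∀ {m n} → (m ≤ᵇ n) ≡ true → m ≤ n
≤ᵇ⇒≤ {m} {n} e = ℕₚ.≤ᵇ⇒≤ m n (≡.subst T (≡.sym e) _)

≰⇒≤ᵇ-false : ∀ {m n} → ¬ (m ≤ n) → (m ≤ᵇ n) ≡ false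
≰⇒≤ᵇ-false {m} {n} m≰n with m ≤ᵇ n in e
... | false = ≡.refl
... | true  = ⊥-elim (m≰n (≤ᵇ⇒≤ e))

≤ᵇ-false⇒≰ : ∀ {m n} → (m ≤ᵇ n) ≡ false → ¬ (m ≤ n)
≤ᵇ-false⇒≰ e m≤n with ≡.trans (≡.sym (≤⇒≤ᵇ m≤n)) e
... | ()

≡ᵇ-refl : ∀ n → (n ≡ᵇ n) ≡ true
≡ᵇ-refl zero    = ≡.refl
≡ᵇ-refl (suc n) = ≡ᵇ-refl n

≢⇒≡ᵇ-false : ∀ {m n} → m ≢ n → (m ≡ᵇ n) ≡ false
≢⇒≡ᵇ-false {zero}  {zero}  m≢n = ⊥-elim (m≢n ≡.refl)
≢⇒≡ᵇ-false {zero}  {suc n} m≢n = ≡.refl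
≢⇒≡ᵇ-false {suc m} {zero}  m≢n = ≡.refl
≢⇒≡ᵇ-false {suc m} {suc n} m≢n = ≢⇒≡ᵇ-false (λ e → m≢n (≡.cong suc e))

leqTGo-refl : ∀ s (as : List ℕ) → leqTGo s s as as ≡ true
leqTGo-refl s []       = ≡.refl
leqTGo-refl s (a ∷ as) = ∧-true (≤⇒≤ᵇ {s ℕ.+ a} ℕₚ.≤-refl) (leqTGo-refl (s ℕ.+ a) as)

leqTGo-trans : ∀ sa sb sc (as bs cs : List ℕ) →
  leqTGo sa sb as bs ≡ true → leqTGo sb sc bs cs ≡ true → leqTGo sa sc as cs ≡ true
leqTGo-trans sa sb sc []       []       []       _  _  = ≡.refl
leqTGo-trans sa sb sc (a ∷ as) (b ∷ bs) (c ∷ cs) e₁ e₂ =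
  ∧-true (≤⇒≤ᵇ {sa ℕ.+ a} {sc ℕ.+ c} (ℕₚ.≤-trans (≤ᵇ⇒≤ (∧-trueˡ e₁)) (≤ᵇ⇒≤ (∧-trueˡ e₂))))
         (leqTGo-trans _ _ _ as bs cs (∧-trueʳ e₁) (∧-trueʳ e₂))
leqTGo-trans sa sb sc []      []      (_ ∷ _) _  ()
leqTGo-trans sa sb sc []      (_ ∷ _) _       () _
leqTGo-trans sa sb sc (_ ∷ _) []      _       () _
leqTGo-trans sa sb sc (_ ∷ _) (_ ∷ _) []      _  ()

leqTGo-antisym : ∀ s (as bs : List ℕ) → leqTGo s s as bs ≡ true → leqTGo s s bs as ≡ true → as ≡ bs
leqTGo-antisym s []       []       _  _  = ≡.refl
leqTGo-antisym s (a ∷ as) (b ∷ bs) e₁ e₂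
  with ℕₚ.+-cancelˡ-≡ s a b (ℕₚ.≤-antisym (≤ᵇ⇒≤ (∧-trueˡ e₁)) (≤ᵇ⇒≤ (∧-trueˡ e₂)))
... | ≡.refl = ≡.cong (a ∷_) (leqTGo-antisym (s ℕ.+ a) as bs (∧-trueʳ e₁) (∧-trueʳ e₂))
leqTGo-antisym s []      (_ ∷ _) () _
leqTGo-antisym s (_ ∷ _) []      () _

leqTGo⇒sum≤ : ∀ sa sb (as bs : List ℕ) → sa ≤ sb → leqTGo sa sb as bs ≡ true →
  sa ℕ.+ sum as ≤ sb ℕ.+ sum bs
leqTGo⇒sum≤ sa sb []       []       sa≤sb _ =
  ≡.subst₂ _≤_ (≡.sym (ℕₚ.+-identityʳ sa)) (≡.sym (ℕₚ.+-identityʳ sb)) sa≤sb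
leqTGo⇒sum≤ sa sb (a ∷ as) (b ∷ bs) _     e =
  ≡.subst₂ _≤_ (ℕₚ.+-assoc sa a (sum as)) (ℕₚ.+-assoc sb b (sum bs))
    (leqTGo⇒sum≤ (sa ℕ.+ a) (sb ℕ.+ b) as bs (≤ᵇ⇒≤ (∧-trueˡ e)) (∧-trueʳ e))
leqTGo⇒sum≤ sa sb []      (_ ∷ _) _ ()
leqTGo⇒sum≤ sa sb (_ ∷ _) []      _ ()

leqT⇒sum≤ : ∀ (as bs : List ℕ) → leqT as bs ≡ true → sum as ≤ sum bs
leqT⇒sum≤ as bs = leqTGo⇒sum≤ 0 0 as bs z≤n

replicate-0-leqTGo : ∀ s t (cs : List ℕ) → s ≤ t → leqTGo s t (replicate (length cs) 0) cs ≡ true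
replicate-0-leqTGo s t []       s≤t = ≡.refl
replicate-0-leqTGo s t (c ∷ cs) s≤t = ∧-true (≤⇒≤ᵇ s+0≤t+c) (replicate-0-leqTGo (s ℕ.+ 0) (t ℕ.+ c) cs s+0≤t+c)
  where
  s+0≤t+c : s ℕ.+ 0 ≤ t ℕ.+ c
  s+0≤t+c = ℕₚ.+-mono-≤ s≤t z≤n

leqP-trans : ∀ {g} (a b c : Vec (List ℕ) g) → leqP a b ≡ true → leqP b c ≡ true → leqP a c ≡ true
leqP-trans []       []       []       _  _  = ≡.refl
leqP-trans (a ∷ as) (b ∷ bs) (c ∷ cs) e₁ e₂ =
  ∧-true (leqTGo-trans 0 0 0 a b c (∧-trueˡ e₁) (∧-trueˡ e₂)) (leqP-trans as bs cs (∧-trueʳ e₁) (∧-trueʳ e₂))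

leqP-antisym : ∀ {g} (a b : Vec (List ℕ) g) → leqP a b ≡ true → leqP b a ≡ true → a ≡ b
leqP-antisym []       []       _  _  = ≡.refl
leqP-antisym (a ∷ as) (b ∷ bs) e₁ e₂ =
  ≡.cong₂ _∷_ (leqTGo-antisym 0 a b (∧-trueˡ e₁) (∧-trueˡ e₂)) (leqP-antisym as bs (∧-trueʳ e₁) (∧-trueʳ e₂))

_≟P_ : ∀ {g} (a b : Vec (List ℕ) g) → Dec (a ≡ b)
_≟P_ = Vecₚ.≡-dec (Listₚ.≡-dec ℕₚ._≟_)

≡⇒eqP : ∀ {g} {a b : Vec (List ℕ) g} → a ≡ b → eqP a b ≡ true
≡⇒eqP {a = a} {b} = dec-true (a ≟P b)

≢⇒eqP-false : ∀ {g} {a b : Vec (List ℕ) g} → a ≢ b → eqP a b ≡ false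
≢⇒eqP-false {a = a} {b} = dec-false (a ≟P b)

ltP⇒leqP : ∀ {g} (a b : Vec (List ℕ) g) → ltP a b ≡ true → leqP a b ≡ true
ltP⇒leqP a b = ∧-trueˡ

ltP⇒≢ : ∀ {g} (a b : Vec (List ℕ) g) → ltP a b ≡ true → a ≢ b
ltP⇒≢ a b e a≡b with ≡.subst (λ t → not t ≡ true) (≡⇒eqP a≡b) (∧-trueʳ {leqP a b} e)
... | ()

leqP∧≢⇒ltP : ∀ {g} {a b : Vec (List ℕ) g} → leqP a b ≡ true → a ≢ b → ltP a b ≡ true
leqP∧≢⇒ltP {a = a} {b} a≤b a≢b rewrite ≢⇒eqP-false a≢b = ∧-true a≤b ≡.refl

ltP-irrefl : ∀ {g} (a : Vec (List ℕ) g) → ltP a a ≡ false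
ltP-irrefl a with ltP a a in e
... | false = ≡.refl
... | true  = ⊥-elim (ltP⇒≢ a a e ≡.refl)

leqP-ltP-trans : ∀ {g} (a b c : Vec (List ℕ) g) → leqP a b ≡ true → ltP b c ≡ true → ltP a c ≡ true
leqP-ltP-trans a b c a≤b b<c = leqP∧≢⇒ltP (leqP-trans a b c a≤b (ltP⇒leqP b c b<c)) a≢c
  where
  a≢c : a ≢ c
  a≢c ≡.refl = ltP⇒≢ b a b<c (leqP-antisym b a (ltP⇒leqP b a b<c) a≤b)

ltP-trans : ∀ {g} (a b c : Vec (List ℕ) g) → ltP a b ≡ true → ltP b c ≡ true → ltP a c ≡ true
ltP-trans a b c a<b = leqP-ltP-trans a b c (ltP⇒leqP a b a<b)

ltP-asym : ∀ {g} (a b : Vec (List ℕ) g) → ltP a b ≡ true → ltP b a ≡ false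
ltP-asym a b a<b with ltP b a in e
... | false = ≡.refl
... | true  = ⊥-elim (ltP⇒≢ a b a<b (leqP-antisym a b (ltP⇒leqP a b a<b) (ltP⇒leqP b a e)))

data BitString : ℕ → List ℕ → Set where
  []  : BitString 0 []
  _∷_ : ∀ {n x α} → x ≤ 1 → BitString n α → BitString (suc n) (x ∷ α)

data InP (n r : ℕ) : List ℕ → Set where
  _∷_ : ∀ {a₀ α} → a₀ ≤ r → BitString n α → InP n r (a₀ ∷ α)

data InPs : ∀ {g} → Vec ℕ g → Vec ℕ g → Vec (List ℕ) g → Set where
  []  : InPs [] [] []
  _∷_ : ∀ {g n r a} {ns rs : Vec ℕ g} {as} → InP n r a → InPs ns rs as → InPs (n ∷ ns) (r ∷ rs) (a ∷ as)

BitString-length : ∀ {n α} → BitString n α → length α ≡ n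
BitString-length []      = ≡.refl
BitString-length (_ ∷ b) = ≡.cong suc (BitString-length b)

BitString-replicate : ∀ n {x} → x ≤ 1 → BitString n (replicate n x)
BitString-replicate zero    x≤1 = []
BitString-replicate (suc n) x≤1 = x≤1 ∷ BitString-replicate n x≤1

record Snoc (n : ℕ) (α : List ℕ) : Set where
  constructor snoc
  field
    {init} : List ℕ
    {last} : ℕ
    α≡     : α ≡ init ∷ʳ last
    init∈  : BitString n init
    last≤1 : last ≤ 1

snocView : ∀ {n α} → BitString (suc n) α → Snoc n α
snocView (x≤1 ∷ [])          = snoc ≡.refl [] x≤1
snocView (x≤1 ∷ (y≤1 ∷ b)) with snocView (y≤1 ∷ b)
... | snoc α≡ b′ z≤1 = snoc (≡.cong (_ ∷_) α≡) (x≤1 ∷ b′) z≤1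

∈-bits⁻ : ∀ n {α} → α ∈ bits n → BitString n α
∈-bits⁻ zero    (here ≡.refl) = []
∈-bits⁻ (suc n) α∈ with find (∈-concatMap⁻ (λ b → map (b ∷_) (bits n)) {xs = 0 ∷ 1 ∷ []} α∈)
... | b , b∈ , α∈′ with ∈-map⁻ (b ∷_) α∈′
... | _ , α′∈ , ≡.refl = bit≤1 b∈ ∷ ∈-bits⁻ n α′∈
  where
  bit≤1 : ∀ {b} → b ∈ 0 ∷ 1 ∷ [] → b ≤ 1
  bit≤1 (here ≡.refl)         = z≤n
  bit≤1 (there (here ≡.refl)) = s≤s z≤n

∈-bits⁺ : ∀ {n α} → BitString n α → α ∈ bits n
∈-bits⁺ []                       = here ≡.refl
∈-bits⁺ {suc n} (_∷_ {x = zero} _ b) =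
  ∈-concatMap⁺ (λ b′ → map (b′ ∷_) (bits n)) {xs = 0 ∷ 1 ∷ []} (here (∈-map⁺ (0 ∷_) (∈-bits⁺ b)))
∈-bits⁺ {suc n} (_∷_ {x = suc zero} _ b) =
  ∈-concatMap⁺ (λ b′ → map (b′ ∷_) (bits n)) {xs = 0 ∷ 1 ∷ []} (there (here (∈-map⁺ (1 ∷_) (∈-bits⁺ b))))
∈-bits⁺ (_∷_ {x = suc (suc _)} (s≤s ()) _)

∈-elemsP⁻ : ∀ n r {a} → a ∈ elemsP n r → InP n r a
∈-elemsP⁻ n r a∈ with find (∈-concatMap⁻ (λ a₀ → map (a₀ ∷_) (bits n)) {xs = upTo (suc r)} a∈)
... | a₀ , a₀∈ , a∈′ with ∈-map⁻ (a₀ ∷_) a∈′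
... | _ , α∈ , ≡.refl = ℕₚ.≤-pred (∈-upTo⁻ a₀∈) ∷ ∈-bits⁻ n α∈

∈-elemsP⁺ : ∀ {n r a} → InP n r a → a ∈ elemsP n r
∈-elemsP⁺ {n} {r} (_∷_ {a₀} a₀≤r b) =
  ∈-concatMap⁺ (λ a₀′ → map (a₀′ ∷_) (bits n)) {xs = upTo (suc r)}
    (Any.map (λ { ≡.refl → ∈-map⁺ (a₀ ∷_) (∈-bits⁺ b) }) (∈-upTo⁺ (s≤s a₀≤r)))

∈-allP⁻ : ∀ {g} (ns rs : Vec ℕ g) {c} → c ∈ allP ns rs → InPs ns rs c
∈-allP⁻ []       []       (here ≡.refl) = []
∈-allP⁻ (n ∷ ns) (r ∷ rs) c∈ with find (∈-concatMap⁻ (λ a → map (a ∷_) (allP ns rs)) {xs = elemsP n r} c∈)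
... | a , a∈ , c∈′ with ∈-map⁻ (a ∷_) c∈′
... | _ , as∈ , ≡.refl = ∈-elemsP⁻ n r a∈ ∷ ∈-allP⁻ ns rs as∈

∈-allP⁺ : ∀ {g} {ns rs : Vec ℕ g} {c} → InPs ns rs c → c ∈ allP ns rs
∈-allP⁺ []                                 = here ≡.refl
∈-allP⁺ {ns = n ∷ ns} {r ∷ rs} (_∷_ {a = a} a∈ as∈) =
  ∈-concatMap⁺ (λ a′ → map (a′ ∷_) (allP ns rs)) {xs = elemsP n r}
    (Any.map (λ { ≡.refl → ∈-map⁺ (a ∷_) (∈-allP⁺ as∈) }) (∈-elemsP⁺ a∈))

top∈ : ∀ {g} (ns rs : Vec ℕ g) → InPs ns rs (top ns rs)
top∈ []       []       = []
top∈ (n ∷ ns) (r ∷ rs) = (ℕₚ.≤-refl ∷ BitString-replicate n ℕₚ.≤-refl) ∷ top∈ ns rs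

bot∈ : ∀ {g} (ns rs : Vec ℕ g) → InPs ns rs (bot ns)
bot∈ []       []       = []
bot∈ (n ∷ ns) (r ∷ rs) = (z≤n ∷ BitString-replicate n z≤n) ∷ bot∈ ns rs

bot-leqP : ∀ {g} {ns rs : Vec ℕ g} {c} → InPs ns rs c → leqP (bot ns) c ≡ true
bot-leqP []                                   = ≡.refl
bot-leqP {ns = n ∷ ns} (_∷_ {a₀ = a₀} {α} _ b ∷ c∈) =
  ∧-true (≡.subst (λ k → leqTGo 0 a₀ (replicate k 0) α ≡ true) (BitString-length b)
                  (replicate-0-leqTGo 0 a₀ α z≤n))
         (bot-leqP c∈)

_≟L_ : (a b : List ℕ) → Dec (a ≡ b)
_≟L_ = Listₚ.≡-dec ℕₚ._≟_

eqL : List ℕ → List ℕ → Bool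
eqL a b = does (a ≟L b)

≡⇒eqL : ∀ {a b} → a ≡ b → eqL a b ≡ true
≡⇒eqL {a} {b} = dec-true (a ≟L b)

≢⇒eqL-false : ∀ {a b} → a ≢ b → eqL a b ≡ false
≢⇒eqL-false {a} {b} = dec-false (a ≟L b)

eqL-single : ∀ a₀ b₀ → eqL (a₀ ∷ []) (b₀ ∷ []) ≡ (a₀ ≡ᵇ b₀)
eqL-single a₀ b₀ with a₀ ℕₚ.≟ b₀
... | yes ≡.refl = ≡.trans (≡⇒eqL {a₀ ∷ []} ≡.refl) (≡.sym (≡ᵇ-refl a₀))
... | no  a₀≢b₀  = ≡.trans (≢⇒eqL-false {a₀ ∷ []} {b₀ ∷ []} (λ e → a₀≢b₀ (proj₁ (Listₚ.∷-injective e))))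
                         (≡.sym (≢⇒≡ᵇ-false a₀≢b₀))

filterᵇ-accept : ∀ {A : Set} (p : A → Bool) {x} xs → p x ≡ true → filterᵇ p (x ∷ xs) ≡ x ∷ filterᵇ p xs
filterᵇ-accept p xs px rewrite px = ≡.refl

filterᵇ-reject : ∀ {A : Set} (p : A → Bool) {x} xs → p x ≡ false → filterᵇ p (x ∷ xs) ≡ filterᵇ p xs
filterᵇ-reject p xs px rewrite px = ≡.refl

filterᵇ-filterᵇ : ∀ {A : Set} (p q : A → Bool) → (∀ x → p x ≡ true → q x ≡ true) →
  ∀ xs → filterᵇ p (filterᵇ q xs) ≡ filterᵇ p xs
filterᵇ-filterᵇ p q p⇒q []       = ≡.refl
filterᵇ-filterᵇ p q p⇒q (x ∷ xs) = by-cases (q x) ≡.refl (p x) ≡.refl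
  where
  IH = filterᵇ-filterᵇ p q p⇒q xs
  by-cases : ∀ bq → q x ≡ bq → ∀ bp → p x ≡ bp → filterᵇ p (filterᵇ q (x ∷ xs)) ≡ filterᵇ p (x ∷ xs)
  by-cases true  qx true  px = ≡.trans (≡.cong (filterᵇ p) (filterᵇ-accept q xs qx))
                                 (≡.trans (filterᵇ-accept p _ px) (≡.trans (≡.cong (x ∷_) IH) (≡.sym (filterᵇ-accept p xs px))))
  by-cases true  qx false px = ≡.trans (≡.cong (filterᵇ p) (filterᵇ-accept q xs qx))
                                 (≡.trans (filterᵇ-reject p _ px) (≡.trans IH (≡.sym (filterᵇ-reject p xs px))))
  by-cases false qx false px = ≡.trans (≡.cong (filterᵇ p) (filterᵇ-reject q xs qx)) (≡.trans IH (≡.sym (filterᵇ-reject p xs px)))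
  by-cases false qx true  px with () ← ≡.trans (≡.sym qx) (p⇒q x px)

length-filterᵇ-< : ∀ {A : Set} (p q : A → Bool) → (∀ x → p x ≡ true → q x ≡ true) →
  ∀ {x xs} → x ∈ xs → q x ≡ true → p x ≡ false → length (filterᵇ p xs) < length (filterᵇ q xs)
length-filterᵇ-< p q p⇒q {x} {xs} x∈ qx px =
  ≡.subst (λ n → n < length (filterᵇ q xs)) (≡.cong length (filterᵇ-filterᵇ p q p⇒q xs))
    (Listₚ.filter-notAll (T? ∘ p) (filterᵇ q xs)
      (Any.map (λ { ≡.refl → ≡.subst T px }) (∈-filter⁺ (T? ∘ q) x∈ (≡.subst T (≡.sym qx) _))))

sum-replicate : ∀ n x → sum (replicate n x) ≡ n ℕ.* x
sum-replicate zero    x = ≡.refl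
sum-replicate (suc n) x = ≡.cong (x ℕ.+_) (sum-replicate n x)

bigN≡0⇒bot≡top : ∀ {g} (ns rs : Vec ℕ g) → bigN ns rs ≡ 0 → bot ns ≡ top ns rs
bigN≡0⇒bot≡top []       []       _ = ≡.refl
bigN≡0⇒bot≡top (n ∷ ns) (r ∷ rs) N≡0
  with ℕₚ.m+n≡0⇒m≡0 n (ℕₚ.m+n≡0⇒m≡0 (n ℕ.+ r) N≡0) | ℕₚ.m+n≡0⇒n≡0 n (ℕₚ.m+n≡0⇒m≡0 (n ℕ.+ r) N≡0)
... | ≡.refl | ≡.refl = ≡.cong ((0 ∷ []) ∷_) (bigN≡0⇒bot≡top ns rs (ℕₚ.m+n≡0⇒n≡0 (n ℕ.+ r) N≡0))

bot≡top⇒bigN≡0 : ∀ {g} (ns rs : Vec ℕ g) → bot ns ≡ top ns rs → bigN ns rs ≡ 0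
bot≡top⇒bigN≡0 []       []       _ = ≡.refl
bot≡top⇒bigN≡0 (n ∷ ns) (r ∷ rs) e with Listₚ.∷-injective (Vecₚ.∷-injectiveˡ e)
... | ≡.refl , zeros≡ones with n | zeros≡ones
...   | zero | _ = bot≡top⇒bigN≡0 ns rs (Vecₚ.∷-injectiveʳ e)

module Reciprocity {c ℓ} (R : CommutativeRing c ℓ) where

  open CommutativeRing R
  open Eval R
  open IntegerRingSolver R
  open import Algebra.Properties.Ring ring using (-0#≈0#; -‿+-comm; -‿involutive; -1*x≈-x)
  open import Relation.Binary.Reasoning.Setoid setoid

  private
    variable
      ℓ′ : Level
      A A′ B : Set ℓ′

  -- Finite sums

  ∑ : List A → (A → Carrier) → Carrier
  ∑ []       f = 0#
  ∑ (x ∷ xs) f = f x + ∑ xs f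

  ∑-cong : (xs : List A) {f g : A → Carrier} → (∀ x → f x ≈ g x) → ∑ xs f ≈ ∑ xs g
  ∑-cong []       f≈g = refl
  ∑-cong (x ∷ xs) f≈g = +-cong (f≈g x) (∑-cong xs f≈g)

  ∑-cong∈ : (xs : List A) {f g : A → Carrier} → (∀ x → x ∈ xs → f x ≈ g x) → ∑ xs f ≈ ∑ xs g
  ∑-cong∈ []       f≈g = refl
  ∑-cong∈ (x ∷ xs) f≈g = +-cong (f≈g x (here ≡.refl)) (∑-cong∈ xs (λ y y∈ → f≈g y (there y∈)))

  ∑-zero∈ : (xs : List A) {f : A → Carrier} → (∀ x → x ∈ xs → f x ≈ 0#) → ∑ xs f ≈ 0#
  ∑-zero∈ []       f≈0 = refl
  ∑-zero∈ (x ∷ xs) f≈0 = trans (+-cong (f≈0 x (here ≡.refl)) (∑-zero∈ xs (λ y y∈ → f≈0 y (there y∈)))) (+-identityˡ 0#)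

  ∑-zero : (xs : List A) {f : A → Carrier} → (∀ x → f x ≈ 0#) → ∑ xs f ≈ 0#
  ∑-zero xs f≈0 = ∑-zero∈ xs (λ x _ → f≈0 x)

  ∑-+ : (xs : List A) (f g : A → Carrier) → ∑ xs (λ x → f x + g x) ≈ ∑ xs f + ∑ xs g
  ∑-+ []       f g = sym (+-identityˡ 0#)
  ∑-+ (x ∷ xs) f g = trans (+-congˡ (∑-+ xs f g))
    (solve 4 (λ a b c d → (a :+ b) :+ (c :+ d) := (a :+ c) :+ (b :+ d)) refl (f x) (g x) (∑ xs f) (∑ xs g))

  ∑-*ˡ : (xs : List A) (k : Carrier) (f : A → Carrier) → ∑ xs (λ x → k * f x) ≈ k * ∑ xs f
  ∑-*ˡ []       k f = sym (zeroʳ k)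
  ∑-*ˡ (x ∷ xs) k f = trans (+-congˡ (∑-*ˡ xs k f)) (sym (distribˡ k (f x) (∑ xs f)))

  ∑-*ʳ : (xs : List A) (k : Carrier) (f : A → Carrier) → ∑ xs (λ x → f x * k) ≈ ∑ xs f * k
  ∑-*ʳ []       k f = sym (zeroˡ k)
  ∑-*ʳ (x ∷ xs) k f = trans (+-congˡ (∑-*ʳ xs k f)) (sym (distribʳ k (f x) (∑ xs f)))

  ∑-neg : (xs : List A) (f : A → Carrier) → ∑ xs (λ x → - f x) ≈ - ∑ xs f
  ∑-neg []       f = sym -0#≈0#
  ∑-neg (x ∷ xs) f = trans (+-congˡ (∑-neg xs f)) (-‿+-comm (f x) (∑ xs f))

  ∑-++ : (xs ys : List A) (f : A → Carrier) → ∑ (xs ++ ys) f ≈ ∑ xs f + ∑ ys f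
  ∑-++ []       ys f = sym (+-identityˡ _)
  ∑-++ (x ∷ xs) ys f = trans (+-congˡ (∑-++ xs ys f)) (sym (+-assoc (f x) (∑ xs f) (∑ ys f)))

  ∑-concatMap : (xs : List A) (g : A → List B) (f : B → Carrier) →
    ∑ (concatMap g xs) f ≈ ∑ xs (λ x → ∑ (g x) f)
  ∑-concatMap []       g f = refl
  ∑-concatMap (x ∷ xs) g f = trans (∑-++ (g x) (concatMap g xs) f) (+-congˡ (∑-concatMap xs g f))

  ∑-map : (xs : List A) (h : A → B) (f : B → Carrier) → ∑ (map h xs) f ≈ ∑ xs (λ x → f (h x))
  ∑-map []       h f = refl
  ∑-map (x ∷ xs) h f = +-congˡ (∑-map xs h f)

  ∑-concatMap-map : (xs : List A) (ys : A → List A′) (h : A → A′ → B) (f : B → Carrier) →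
    ∑ (concatMap (λ x → map (h x) (ys x)) xs) f ≈ ∑ xs (λ x → ∑ (ys x) (λ y → f (h x y)))
  ∑-concatMap-map xs ys h f =
    trans (∑-concatMap xs (λ x → map (h x) (ys x)) f) (∑-cong xs (λ x → ∑-map (ys x) (h x) f))

  ∑-swap : (xs : List A) (ys : List B) (F : A → B → Carrier) →
    ∑ xs (λ x → ∑ ys (F x)) ≈ ∑ ys (λ y → ∑ xs (λ x → F x y))
  ∑-swap []       ys F = sym (∑-zero ys (λ _ → refl))
  ∑-swap (x ∷ xs) ys F = trans (+-congˡ (∑-swap xs ys F)) (sym (∑-+ ys (F x) (λ y → ∑ xs (λ x′ → F x′ y))))

  ∑-*-∑ : (xs : List A) (ys : List B) (f : A → Carrier) (g : B → Carrier) →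
    ∑ xs (λ x → ∑ ys (λ y → f x * g y)) ≈ ∑ xs f * ∑ ys g
  ∑-*-∑ xs ys f g = trans (∑-cong xs (λ x → ∑-*ˡ ys (f x) g)) (∑-*ʳ xs (∑ ys g) f)

  foldr-map≈∑ : (xs : List A) (h : A → Carrier) → foldr _+_ 0# (map h xs) ≈ ∑ xs h
  foldr-map≈∑ []       h = refl
  foldr-map≈∑ (x ∷ xs) h = +-congˡ (foldr-map≈∑ xs h)

  ∑< : ℕ → (ℕ → Carrier) → Carrier
  ∑< zero    H = 0#
  ∑< (suc n) H = H 0 + ∑< n (λ i → H (suc i))

  ∑<-cong : ∀ n {H H′} → (∀ i → H i ≈ H′ i) → ∑< n H ≈ ∑< n H′
  ∑<-cong zero    H≈H′ = refl
  ∑<-cong (suc n) H≈H′ = +-cong (H≈H′ 0) (∑<-cong n (λ i → H≈H′ (suc i)))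

  ∑<-zero : ∀ n {H} → (∀ i → H i ≈ 0#) → ∑< n H ≈ 0#
  ∑<-zero zero    H≈0 = refl
  ∑<-zero (suc n) H≈0 = trans (+-cong (H≈0 0) (∑<-zero n (λ i → H≈0 (suc i)))) (+-identityˡ 0#)

  ∑<-+ : ∀ n H H′ → ∑< n (λ i → H i + H′ i) ≈ ∑< n H + ∑< n H′
  ∑<-+ zero    H H′ = sym (+-identityˡ 0#)
  ∑<-+ (suc n) H H′ = trans (+-congˡ (∑<-+ n _ _))
    (solve 4 (λ a b c d → (a :+ b) :+ (c :+ d) := (a :+ c) :+ (b :+ d)) refl
       (H 0) (H′ 0) (∑< n (λ i → H (suc i))) (∑< n (λ i → H′ (suc i))))

  ∑<-*ˡ : ∀ n k H → ∑< n (λ i → k * H i) ≈ k * ∑< n H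
  ∑<-*ˡ zero    k H = sym (zeroʳ k)
  ∑<-*ˡ (suc n) k H = trans (+-congˡ (∑<-*ˡ n k _)) (sym (distribˡ k _ _))

  ∑<-neg : ∀ n H → ∑< n (λ i → - H i) ≈ - ∑< n H
  ∑<-neg zero    H = sym -0#≈0#
  ∑<-neg (suc n) H = trans (+-congˡ (∑<-neg n _)) (-‿+-comm _ _)

  ∑<-last : ∀ n H → ∑< (suc n) H ≈ ∑< n H + H n
  ∑<-last zero    H = trans (+-identityʳ _) (sym (+-identityˡ _))
  ∑<-last (suc n) H = trans (+-congˡ (∑<-last n (λ i → H (suc i)))) (sym (+-assoc _ _ _))

  ∑-upTo : ∀ n (H : ℕ → Carrier) → ∑ (upTo n) H ≈ ∑< n H
  ∑-upTo n H = go n (λ i → i)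
    where
    go : ∀ n (f : ℕ → ℕ) → ∑ (applyUpTo f n) H ≈ ∑< n (λ i → H (f i))
    go zero    f = refl
    go (suc n) f = +-congˡ (go n (λ i → f (suc i)))

  infix 8 [_]_
  [_]_ : Bool → Carrier → Carrier
  [ b ] x = if b then x else 0#

  []-true : ∀ {b} x → b ≡ true → [ b ] x ≈ x
  []-true x ≡.refl = refl

  []-false : ∀ {b} x → b ≡ false → [ b ] x ≈ 0#
  []-false x ≡.refl = refl

  []-cong : ∀ b {x y} → (b ≡ true → x ≈ y) → [ b ] x ≈ [ b ] y
  []-cong true  x≈y = x≈y ≡.refl
  []-cong false x≈y = refl

  []-∧ : ∀ b₁ b₂ x → [ b₁ ∧ b₂ ] x ≈ [ b₁ ] ([ b₂ ] x)
  []-∧ true  b₂ x = refl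
  []-∧ false b₂ x = refl

  []-∧-* : ∀ b₁ b₂ x y → [ b₁ ∧ b₂ ] (x * y) ≈ [ b₁ ] x * [ b₂ ] y
  []-∧-* true  true  x y = refl
  []-∧-* true  false x y = sym (zeroʳ _)
  []-∧-* false b₂    x y = sym (zeroˡ _)

  []-*ˡ : ∀ b k x → [ b ] (k * x) ≈ k * [ b ] x
  []-*ˡ true  k x = refl
  []-*ˡ false k x = sym (zeroʳ k)

  []-*ʳ : ∀ b k x → [ b ] (x * k) ≈ [ b ] x * k
  []-*ʳ true  k x = refl
  []-*ʳ false k x = sym (zeroˡ k)

  []-+ : ∀ b x y → [ b ] (x + y) ≈ [ b ] x + [ b ] y
  []-+ true  x y = refl
  []-+ false x y = sym (+-identityˡ 0#)

  []-neg : ∀ b x → [ b ] (- x) ≈ - [ b ] x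
  []-neg true  x = refl
  []-neg false x = sym -0#≈0#

  []-0# : ∀ b → [ b ] 0# ≈ 0#
  []-0# true  = refl
  []-0# false = refl

  []-∑ : ∀ b (xs : List A) (f : A → Carrier) → [ b ] ∑ xs f ≈ ∑ xs (λ x → [ b ] f x)
  []-∑ true  xs f = refl
  []-∑ false xs f = sym (∑-zero xs (λ _ → refl))

  ∑∑-[∧] : (xs : List A) (ys : List A′) (p : A → Bool) (p′ : A′ → Bool) (F : A → A′ → Carrier) →
    ∑ xs (λ a → ∑ ys (λ a′ → [ p a ∧ p′ a′ ] F a a′)) ≈ ∑ xs (λ a → [ p a ] ∑ ys (λ a′ → [ p′ a′ ] F a a′))
  ∑∑-[∧] xs ys p p′ F =
    ∑-cong xs (λ a → trans (∑-cong ys (λ a′ → []-∧ (p a) (p′ a′) (F a a′))) (sym ([]-∑ (p a) ys _)))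

  ∑<-δ : ∀ m q (H : ℕ → Carrier) → q < m → ∑< m (λ i → [ i ≡ᵇ q ] H i) ≈ H q
  ∑<-δ (suc m) zero    H _         = trans (+-congˡ (∑<-zero m (λ _ → refl))) (+-identityʳ _)
  ∑<-δ (suc m) (suc q) H (s≤s q<m) = trans (+-identityˡ _) (∑<-δ m q (λ i → H (suc i)) q<m)

  -- Powers, signs and Gaussian binomials

  pow-cong : ∀ {x y} k → x ≈ y → pow x k ≈ pow y k
  pow-cong zero    x≈y = refl
  pow-cong (suc k) x≈y = *-cong x≈y (pow-cong k x≈y)

  pow-+ : ∀ x m n → pow x (m ℕ.+ n) ≈ pow x m * pow x n
  pow-+ x zero    n = sym (*-identityˡ _)
  pow-+ x (suc m) n = trans (*-congˡ (pow-+ x m n)) (sym (*-assoc x (pow x m) (pow x n)))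

  pow-* : ∀ x y k → pow (x * y) k ≈ pow x k * pow y k
  pow-* x y zero    = sym (*-identityˡ 1#)
  pow-* x y (suc k) = trans (*-congˡ (pow-* x y k))
    (solve 4 (λ x y a b → (x :* y) :* (a :* b) := (x :* a) :* (y :* b)) refl x y (pow x k) (pow y k))

  pow-1# : ∀ k → pow 1# k ≈ 1#
  pow-1# zero    = refl
  pow-1# (suc k) = trans (*-identityˡ _) (pow-1# k)

  pow-inverse : ∀ {x x′} k → x * x′ ≈ 1# → pow x k * pow x′ k ≈ 1#
  pow-inverse {x} {x′} k xx′≈1 = trans (sym (pow-* x x′ k)) (trans (pow-cong k xx′≈1) (pow-1# k))

  pow-∸ : ∀ x {m n} → m ≤ n → pow x m * pow x (n ∸ m) ≈ pow x n
  pow-∸ x {m} {n} m≤n = trans (sym (pow-+ x m (n ∸ m))) (reflexive (≡.cong (pow x) (ℕₚ.m+[n∸m]≡n m≤n)))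

  sgn : ℕ → Carrier
  sgn k = pow (- 1#) k

  sgn-suc : ∀ k → sgn (suc k) ≈ - sgn k
  sgn-suc k = -1*x≈-x (sgn k)

  sgn-+ : ∀ m n → sgn (m ℕ.+ n) ≈ sgn m * sgn n
  sgn-+ = pow-+ (- 1#)

  sgn-sq : ∀ k → sgn k * sgn k ≈ 1#
  sgn-sq k = pow-inverse k (trans (-1*x≈-x (- 1#)) (-‿involutive 1#))

  gauss-< : ∀ y {n k} → n < k → gauss y n k ≈ 0#
  gauss-< y {zero}  {suc k} _         = refl
  gauss-< y {suc n} {suc k} (s≤s n<k) = begin
    gauss y n k + pow y (suc k) * gauss y n (suc k)   ≈⟨ +-cong (gauss-< y n<k) (*-congˡ (gauss-< y (ℕₚ.m<n⇒m<1+n n<k))) ⟩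
    0# + pow y (suc k) * 0#                           ≈⟨ trans (+-identityˡ _) (zeroʳ _) ⟩
    0#                                                ∎

  gauss-diag : ∀ y n → gauss y n n ≈ 1#
  gauss-diag y zero    = refl
  gauss-diag y (suc n) = begin
    gauss y n n + pow y (suc n) * gauss y n (suc n)   ≈⟨ +-cong (gauss-diag y n) (*-congˡ (gauss-< y (ℕₚ.n<1+n n))) ⟩
    1# + pow y (suc n) * 0#                           ≈⟨ trans (+-congˡ (zeroʳ _)) (+-identityʳ 1#) ⟩
    1#                                                ∎

  private
    telescope : ∀ y a b G → (1# + - pow y a) * G + pow y a * ((1# + - pow y b) * G) ≈ (1# + - pow y (a ℕ.+ b)) * G
    telescope y a b G = trans
      (solve 3 (λ p q G → (𝟙 :- p) :* G :+ p :* ((𝟙 :- q) :* G) := (𝟙 :- p :* q) :* G) refl (pow y a) (pow y b) G)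
      (*-congʳ (+-congˡ (-‿cong (sym (pow-+ y a b)))))

  gauss-ratio : ∀ y n k → (1# + - pow y (suc k)) * gauss y n (suc k) ≈ (1# + - pow y (n ∸ k)) * gauss y n k
  gauss-ratio y zero    zero    = trans (zeroʳ _) (sym (trans (*-identityʳ _) (-‿inverseʳ 1#)))
  gauss-ratio y zero    (suc k) = trans (zeroʳ _) (sym (zeroʳ _))
  gauss-ratio y (suc m) zero    = begin
    (1# + - pow y 1) * (1# + pow y 1 * gauss y m 1)
      ≈⟨ solve 2 (λ p G → (𝟙 :- p) :* (𝟙 :+ p :* G) := (𝟙 :- p) :* 𝟙 :+ p :* ((𝟙 :- p) :* G)) refl (pow y 1) (gauss y m 1) ⟩
    (1# + - pow y 1) * 1# + pow y 1 * ((1# + - pow y 1) * gauss y m 1)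
      ≈⟨ +-congˡ (*-congˡ (gauss-ratio y m 0)) ⟩
    (1# + - pow y 1) * 1# + pow y 1 * ((1# + - pow y m) * 1#)
      ≈⟨ telescope y 1 m 1# ⟩
    (1# + - pow y (suc m)) * 1#
      ∎
  gauss-ratio y (suc m) (suc k) = begin
    (1# + - pow y (2 ℕ.+ k)) * (gauss y m (suc k) + pow y (2 ℕ.+ k) * gauss y m (2 ℕ.+ k))
      ≈⟨ expand (pow y (2 ℕ.+ k)) G (gauss y m (2 ℕ.+ k)) ⟩
    (1# + - pow y (2 ℕ.+ k)) * G + pow y (2 ℕ.+ k) * ((1# + - pow y (2 ℕ.+ k)) * gauss y m (2 ℕ.+ k))
      ≈⟨ +-congˡ (*-congˡ (gauss-ratio y m (suc k))) ⟩
    (1# + - pow y (2 ℕ.+ k)) * G + pow y (2 ℕ.+ k) * ((1# + - pow y (m ∸ suc k)) * G)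
      ≈⟨ telescope y (2 ℕ.+ k) (m ∸ suc k) G ⟩
    (1# + - pow y (2 ℕ.+ k ℕ.+ (m ∸ suc k))) * G
      ≈⟨ same-exponent ⟩
    (1# + - pow y (suc k ℕ.+ (m ∸ k))) * G
      ≈⟨ telescope y (suc k) (m ∸ k) G ⟨
    (1# + - pow y (suc k)) * G + pow y (suc k) * ((1# + - pow y (m ∸ k)) * G)
      ≈⟨ +-congʳ (gauss-ratio y m k) ⟩
    (1# + - pow y (m ∸ k)) * gauss y m k + pow y (suc k) * ((1# + - pow y (m ∸ k)) * G)
      ≈⟨ solve 4 (λ q g p G → (𝟙 :- q) :* g :+ p :* ((𝟙 :- q) :* G) := (𝟙 :- q) :* (g :+ p :* G)) refl
           (pow y (m ∸ k)) (gauss y m k) (pow y (suc k)) G ⟩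
    (1# + - pow y (m ∸ k)) * (gauss y m k + pow y (suc k) * G)
      ∎
    where
    G = gauss y m (suc k)
    expand : ∀ p g h → (1# + - p) * (g + p * h) ≈ (1# + - p) * g + p * ((1# + - p) * h)
    expand = solve 3 (λ p g h → (𝟙 :- p) :* (g :+ p :* h) := (𝟙 :- p) :* g :+ p :* ((𝟙 :- p) :* h)) refl
    -- Both exponents are m + 1 when k < m; otherwise G vanishes.
    same-exponent : (1# + - pow y (2 ℕ.+ k ℕ.+ (m ∸ suc k))) * G ≈ (1# + - pow y (suc k ℕ.+ (m ∸ k))) * G
    same-exponent with k ℕₚ.<? m
    ... | yes k<m = *-congʳ (reflexive (≡.cong (λ e → 1# + - pow y e)
                      (≡.trans (≡.cong suc (ℕₚ.m+[n∸m]≡n k<m)) (≡.sym (≡.cong suc (ℕₚ.m+[n∸m]≡n (ℕₚ.<⇒≤ k<m)))))))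
    ... | no  k≮m = trans (*-congˡ G≈0) (trans (zeroʳ _) (sym (trans (*-congˡ G≈0) (zeroʳ _))))
      where
      G≈0 : G ≈ 0#
      G≈0 = gauss-< y (s≤s (ℕₚ.≮⇒≥ k≮m))

  gauss-pascal′ : ∀ y n k → gauss y (suc n) (suc k) ≈ pow y (n ∸ k) * gauss y n k + gauss y n (suc k)
  gauss-pascal′ y n k = begin
    g + pow y (suc k) * g′
      ≈⟨ solve 4 (λ g g′ p q → g :+ p :* g′ := (q :* g :+ g′) :+ ((𝟙 :- q) :* g :- (𝟙 :- p) :* g′)) refl
           g g′ (pow y (suc k)) (pow y (n ∸ k)) ⟩
    (pow y (n ∸ k) * g + g′) + ((1# + - pow y (n ∸ k)) * g + - ((1# + - pow y (suc k)) * g′))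
      ≈⟨ +-congˡ (trans (+-congˡ (-‿cong (gauss-ratio y n k))) (-‿inverseʳ _)) ⟩
    (pow y (n ∸ k) * g + g′) + 0#
      ≈⟨ +-identityʳ _ ⟩
    pow y (n ∸ k) * g + g′
      ∎
    where
    g  = gauss y n k
    g′ = gauss y n (suc k)

  C2-suc : ∀ k → suc k C 2 ≡ k ℕ.+ k C 2
  C2-suc k = ≡.trans (≡.sym (nCk+nC[k+1]≡[n+1]C[k+1] k 1)) (≡.cong (ℕ._+ (k C 2)) (nC1≡n k))

  μ₀ : Carrier → ℕ → Carrier
  μ₀ Y k = sgn k * pow Y (k C 2)

  μ₀-suc : ∀ Y k → μ₀ Y (suc k) ≈ - (pow Y k * μ₀ Y k)
  μ₀-suc Y k = begin
    sgn (suc k) * pow Y (suc k C 2)         ≈⟨ *-cong (sgn-suc k) (reflexive (≡.cong (pow Y) (C2-suc k))) ⟩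
    - sgn k * pow Y (k ℕ.+ k C 2)           ≈⟨ *-congˡ (pow-+ Y k (k C 2)) ⟩
    - sgn k * (pow Y k * pow Y (k C 2))     ≈⟨ solve 3 (λ s p q → :- s :* (p :* q) := :- (p :* (s :* q))) refl
                                                 (sgn k) (pow Y k) (pow Y (k C 2)) ⟩
    - (pow Y k * (sgn k * pow Y (k C 2)))   ∎

  module GaussianInversion (Y Y′ : Carrier) (inverse : Y * Y′ ≈ 1#) where

    E : ℕ → ℕ → ℕ → Carrier
    E n a b = ∑< n (λ c → gauss Y′ c a * μ₀ Y c * gauss Y b c)

    U : ℕ → ℕ → ℕ → Carrier
    U a b k = gauss Y′ (suc k) a * μ₀ Y k * gauss Y b k

    shifted-term : ∀ a b k → gauss Y′ (suc k) a * μ₀ Y (suc k) * pow Y (b ∸ k) * gauss Y b k ≈ - (pow Y b * U a b k)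
    shifted-term a b k with ℕₚ.≤-<-connex k b
    ... | inj₁ k≤b = begin
      gauss Y′ (suc k) a * μ₀ Y (suc k) * pow Y (b ∸ k) * gauss Y b k
        ≈⟨ *-congʳ (*-congʳ (*-congˡ (μ₀-suc Y k))) ⟩
      gauss Y′ (suc k) a * - (pow Y k * μ₀ Y k) * pow Y (b ∸ k) * gauss Y b k
        ≈⟨ solve 5 (λ g p e q h → g :* :- (p :* e) :* q :* h := :- ((p :* q) :* (g :* e :* h))) refl
             (gauss Y′ (suc k) a) (pow Y k) (μ₀ Y k) (pow Y (b ∸ k)) (gauss Y b k) ⟩
      - ((pow Y k * pow Y (b ∸ k)) * U a b k)
        ≈⟨ -‿cong (*-congʳ (pow-∸ Y k≤b)) ⟩
      - (pow Y b * U a b k)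
        ∎
    ... | inj₂ b<k = begin
      gauss Y′ (suc k) a * μ₀ Y (suc k) * pow Y (b ∸ k) * gauss Y b k   ≈⟨ trans (*-congˡ (gauss-< Y b<k)) (zeroʳ _) ⟩
      0#                                                                ≈⟨ -0#≈0# ⟨
      - 0#                                                              ≈⟨ -‿cong (trans (*-congˡ U≈0) (zeroʳ _)) ⟨
      - (pow Y b * U a b k)                                             ∎
      where
      U≈0 : U a b k ≈ 0#
      U≈0 = trans (*-congˡ (gauss-< Y b<k)) (zeroʳ _)

    E-suc : ∀ n a b → b < n → E (suc n) a (suc b) ≈ E (suc n) a b + - (pow Y b * ∑< (suc n) (U a b))
    E-suc n a b b<n = begin
      X 0 * 1# + ∑< n (λ k → X (suc k) * gauss Y (suc b) (suc k))
        ≈⟨ +-congˡ (∑<-cong n (λ k → trans (*-congˡ (gauss-pascal′ Y b k))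
             (solve 4 (λ x p g h → x :* (p :* g :+ h) := x :* h :+ x :* p :* g) refl
                (X (suc k)) (pow Y (b ∸ k)) (gauss Y b k) (gauss Y b (suc k))))) ⟩
      X 0 * 1# + ∑< n (λ k → X (suc k) * gauss Y b (suc k) + X (suc k) * pow Y (b ∸ k) * gauss Y b k)
        ≈⟨ trans (+-congˡ (∑<-+ n _ _)) (sym (+-assoc _ _ _)) ⟩
      E (suc n) a b + ∑< n (λ k → X (suc k) * pow Y (b ∸ k) * gauss Y b k)
        ≈⟨ +-congˡ (∑<-cong n (shifted-term a b)) ⟩
      E (suc n) a b + ∑< n (λ k → - (pow Y b * U a b k))
        ≈⟨ +-congˡ (trans (∑<-neg n _) (-‿cong (∑<-*ˡ n (pow Y b) (U a b)))) ⟩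
      E (suc n) a b + - (pow Y b * ∑< n (U a b))
        ≈⟨ +-congˡ (-‿cong (*-congˡ ∑U-extend)) ⟨
      E (suc n) a b + - (pow Y b * ∑< (suc n) (U a b))
        ∎
      where
      X : ℕ → Carrier
      X c = gauss Y′ c a * μ₀ Y c
      ∑U-extend : ∑< (suc n) (U a b) ≈ ∑< n (U a b)
      ∑U-extend = trans (∑<-last n (U a b))
                        (trans (+-congˡ (trans (*-congˡ (gauss-< Y b<n)) (zeroʳ _))) (+-identityʳ _))

    ∑U-suc : ∀ a b n → ∑< n (U (suc a) b) ≈ E n a b + pow Y′ (suc a) * E n (suc a) b
    ∑U-suc a b n = trans (∑<-cong n (λ k →
        solve 5 (λ g p h e G → (g :+ p :* h) :* e :* G := g :* e :* G :+ p :* (h :* e :* G)) refl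
          (gauss Y′ k a) (pow Y′ (suc a)) (gauss Y′ k (suc a)) (μ₀ Y k) (gauss Y b k)))
      (trans (∑<-+ n _ _) (+-congˡ (∑<-*ˡ n _ _)))

    δ-recurrence₀ : ∀ b → [ 0 ≡ᵇ b ] μ₀ Y b + - (pow Y b * [ 0 ≡ᵇ b ] μ₀ Y b) ≈ 0#
    δ-recurrence₀ zero    = solve 1 (λ e → e :+ :- (𝟙 :* e) := 𝟘) refl (μ₀ Y 0)
    δ-recurrence₀ (suc b) = solve 1 (λ p → 𝟘 :+ :- (p :* 𝟘) := 𝟘) refl (pow Y (suc b))

    δ-recurrence : ∀ a b →
      [ suc a ≡ᵇ b ] μ₀ Y b + - (pow Y b * ([ a ≡ᵇ b ] μ₀ Y b + pow Y′ (suc a) * [ suc a ≡ᵇ b ] μ₀ Y b))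
        ≈ [ a ≡ᵇ b ] μ₀ Y (suc b)
    δ-recurrence a b with ℕₚ.<-cmp a b
    ... | tri≈ _ ≡.refl _ rewrite ≢⇒≡ᵇ-false {suc a} {a} ℕₚ.1+n≢n | ≡ᵇ-refl a = begin
      0# + - (pow Y a * (μ₀ Y a + pow Y′ (suc a) * 0#))
        ≈⟨ solve 3 (λ p e q → 𝟘 :+ :- (p :* (e :+ q :* 𝟘)) := :- (p :* e)) refl (pow Y a) (μ₀ Y a) (pow Y′ (suc a)) ⟩
      - (pow Y a * μ₀ Y a)
        ≈⟨ μ₀-suc Y a ⟨
      μ₀ Y (suc a)
        ∎
    ... | tri< a<b _ _ with ℕₚ.m≤n⇒m<n∨m≡n a<b
    ...   | inj₂ ≡.refl rewrite ≡ᵇ-refl (suc a) | ≢⇒≡ᵇ-false {a} {suc a} (λ e → ℕₚ.1+n≢n (≡.sym e)) = begin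
      μ₀ Y (suc a) + - (pow Y (suc a) * (0# + pow Y′ (suc a) * μ₀ Y (suc a)))
        ≈⟨ solve 3 (λ e p q → e :+ :- (p :* (𝟘 :+ q :* e)) := e :- (p :* q) :* e) refl
             (μ₀ Y (suc a)) (pow Y (suc a)) (pow Y′ (suc a)) ⟩
      μ₀ Y (suc a) + - ((pow Y (suc a) * pow Y′ (suc a)) * μ₀ Y (suc a))
        ≈⟨ +-congˡ (-‿cong (trans (*-congʳ (pow-inverse (suc a) inverse)) (*-identityˡ _))) ⟩
      μ₀ Y (suc a) + - μ₀ Y (suc a)
        ≈⟨ -‿inverseʳ _ ⟩
      0#
        ∎
    ...   | inj₁ 1+a<b rewrite ≢⇒≡ᵇ-false {suc a} {b} (λ e → ℕₚ.<-irrefl e 1+a<b)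
                             | ≢⇒≡ᵇ-false {a} {b} (λ e → ℕₚ.<-irrefl e a<b) =
      solve 3 (λ p q e → 𝟘 :+ :- (p :* (𝟘 :+ q :* 𝟘)) := 𝟘) refl (pow Y b) (pow Y′ (suc a)) (μ₀ Y b)
    δ-recurrence a b | tri> _ _ b<a rewrite ≢⇒≡ᵇ-false {suc a} {b} (λ e → ℕₚ.<-irrefl (≡.sym e) (ℕₚ.m<n⇒m<1+n b<a))
                                          | ≢⇒≡ᵇ-false {a} {b} (λ e → ℕₚ.<-irrefl (≡.sym e) b<a) =
      solve 3 (λ p q e → 𝟘 :+ :- (p :* (𝟘 :+ q :* 𝟘)) := 𝟘) refl (pow Y b) (pow Y′ (suc a)) (μ₀ Y b)

    E-δ : ∀ b a n → b < n → E n a b ≈ [ a ≡ᵇ b ] μ₀ Y b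
    E-δ zero    zero    (suc n) _ = begin
      1# * μ₀ Y 0 * 1# + ∑< n (λ k → gauss Y′ (suc k) 0 * μ₀ Y (suc k) * 0#)
        ≈⟨ +-congˡ (∑<-zero n (λ _ → zeroʳ _)) ⟩
      1# * μ₀ Y 0 * 1# + 0#
        ≈⟨ solve 1 (λ e → 𝟙 :* e :* 𝟙 :+ 𝟘 := e) refl (μ₀ Y 0) ⟩
      μ₀ Y 0
        ∎
    E-δ zero    (suc a) (suc n) _ = begin
      0# * μ₀ Y 0 * 1# + ∑< n (λ k → gauss Y′ (suc k) (suc a) * μ₀ Y (suc k) * 0#)
        ≈⟨ +-congˡ (∑<-zero n (λ _ → zeroʳ _)) ⟩
      0# * μ₀ Y 0 * 1# + 0#
        ≈⟨ solve 1 (λ e → 𝟘 :* e :* 𝟙 :+ 𝟘 := 𝟘) refl (μ₀ Y 0) ⟩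
      0#
        ∎
    E-δ (suc b) a (suc n) (s≤s b<n) = trans (E-suc n a b b<n) (by-cases a)
      where
      IH : ∀ a → E (suc n) a b ≈ [ a ≡ᵇ b ] μ₀ Y b
      IH a = E-δ b a (suc n) (ℕₚ.m<n⇒m<1+n b<n)
      by-cases : ∀ a → E (suc n) a b + - (pow Y b * ∑< (suc n) (U a b)) ≈ [ a ≡ᵇ suc b ] μ₀ Y (suc b)
      by-cases zero = begin
        E (suc n) 0 b + - (pow Y b * E (suc n) 0 b)
          ≈⟨ +-cong (IH 0) (-‿cong (*-congˡ (IH 0))) ⟩
        [ 0 ≡ᵇ b ] μ₀ Y b + - (pow Y b * [ 0 ≡ᵇ b ] μ₀ Y b)
          ≈⟨ δ-recurrence₀ b ⟩
        0#
          ∎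
      by-cases (suc a) = begin
        E (suc n) (suc a) b + - (pow Y b * ∑< (suc n) (U (suc a) b))
          ≈⟨ +-congˡ (-‿cong (*-congˡ (∑U-suc a b (suc n)))) ⟩
        E (suc n) (suc a) b + - (pow Y b * (E (suc n) a b + pow Y′ (suc a) * E (suc n) (suc a) b))
          ≈⟨ +-cong (IH (suc a)) (-‿cong (*-congˡ (+-cong (IH a) (*-congˡ (IH (suc a)))))) ⟩
        [ suc a ≡ᵇ b ] μ₀ Y b + - (pow Y b * ([ a ≡ᵇ b ] μ₀ Y b + pow Y′ (suc a) * [ suc a ≡ᵇ b ] μ₀ Y b))
          ≈⟨ δ-recurrence a b ⟩
        [ a ≡ᵇ b ] μ₀ Y (suc b)
          ∎

  -- One component: weights, Möbius function and the last coordinate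

  w₁ : (ℕ → Carrier) → List ℕ → List ℕ → Carrier
  w₁ Y a b = theta (Y 0) a b * phi Y a b

  μTail : (ℕ → Carrier) → ℕ → ℕ → List ℕ → Carrier
  μTail Y i s []      = 1#
  μTail Y i s (x ∷ γ) = pow (Y i) s * μTail Y (suc i) (s ℕ.+ x) γ

  μ₁ : (ℕ → Carrier) → List ℕ → Carrier
  μ₁ Y []       = 1#
  μ₁ Y (c₀ ∷ γ) = sgn (c₀ ℕ.+ sum γ) * (pow (Y 0) (c₀ C 2) * μTail Y 1 c₀ γ)

  phi≈[leqT] : ∀ Y a₀ α b₀ β → phi Y (a₀ ∷ α) (b₀ ∷ β) ≈ [ leqT (a₀ ∷ α) (b₀ ∷ β) ] phiGo Y 1 a₀ b₀ α β
  phi≈[leqT] Y a₀ α b₀ β with leqT (a₀ ∷ α) (b₀ ∷ β)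
  ... | true  = refl
  ... | false = refl

  w₁-≰ : ∀ Y a b → leqT a b ≡ false → w₁ Y a b ≈ 0#
  w₁-≰ Y a b a≰b rewrite a≰b = zeroʳ _

  phiGo-diag : ∀ Y i s (α : List ℕ) → phiGo Y i s s α α ≈ 1#
  phiGo-diag Y i s []                  = refl
  phiGo-diag Y i s (zero          ∷ α) = trans (*-identityˡ _) (phiGo-diag Y (suc i) (s ℕ.+ 0) α)
  phiGo-diag Y i s (suc zero      ∷ α) = trans (*-identityˡ _) (phiGo-diag Y (suc i) (s ℕ.+ 1) α)
  phiGo-diag Y i s (suc (suc x)   ∷ α) = trans (*-identityˡ _) (phiGo-diag Y (suc i) (s ℕ.+ suc (suc x)) α)

  w₁-diag : ∀ Y a → w₁ Y a a ≈ 1#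
  w₁-diag Y []       = *-identityˡ _
  w₁-diag Y (a₀ ∷ α) = trans (*-cong (gauss-diag (Y 0) a₀)
    (trans (phi≈[leqT] Y a₀ α a₀ α) (trans ([]-true _ (leqTGo-refl 0 (a₀ ∷ α))) (phiGo-diag Y 1 a₀ α)))) (*-identityˡ _)

  ∑-bits-snoc : ∀ n (H : List ℕ → Carrier) →
    ∑ (bits (suc n)) H ≈ ∑ (bits n) (λ γ → ∑ (0 ∷ 1 ∷ []) (λ z → H (γ ∷ʳ z)))
  ∑-bits-snoc zero    H = sym (+-identityʳ _)
  ∑-bits-snoc (suc n) H = begin
    ∑ (bits (suc (suc n))) H
      ≈⟨ ∑-concatMap-map (0 ∷ 1 ∷ []) (λ _ → bits (suc n)) _∷_ H ⟩
    ∑ (0 ∷ 1 ∷ []) (λ b → ∑ (bits (suc n)) (λ γ → H (b ∷ γ)))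
      ≈⟨ ∑-cong (0 ∷ 1 ∷ []) (λ b → ∑-bits-snoc n (λ γ → H (b ∷ γ))) ⟩
    ∑ (0 ∷ 1 ∷ []) (λ b → ∑ (bits n) (λ γ → ∑ (0 ∷ 1 ∷ []) (λ z → H (b ∷ (γ ∷ʳ z)))))
      ≈⟨ ∑-concatMap-map (0 ∷ 1 ∷ []) (λ _ → bits n) _∷_ _ ⟨
    ∑ (bits (suc n)) (λ γ → ∑ (0 ∷ 1 ∷ []) (λ z → H (γ ∷ʳ z)))
      ∎

  ∑-elemsP-snoc : ∀ n r (H : List ℕ → Carrier) →
    ∑ (elemsP (suc n) r) H ≈ ∑ (elemsP n r) (λ c → ∑ (0 ∷ 1 ∷ []) (λ z → H (c ∷ʳ z)))
  ∑-elemsP-snoc n r H = begin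
    ∑ (elemsP (suc n) r) H
      ≈⟨ ∑-concatMap-map (upTo (suc r)) (λ _ → bits (suc n)) _∷_ H ⟩
    ∑ (upTo (suc r)) (λ a₀ → ∑ (bits (suc n)) (λ γ → H (a₀ ∷ γ)))
      ≈⟨ ∑-cong (upTo (suc r)) (λ a₀ → ∑-bits-snoc n (λ γ → H (a₀ ∷ γ))) ⟩
    ∑ (upTo (suc r)) (λ a₀ → ∑ (bits n) (λ γ → ∑ (0 ∷ 1 ∷ []) (λ z → H (a₀ ∷ (γ ∷ʳ z)))))
      ≈⟨ ∑-concatMap-map (upTo (suc r)) (λ _ → bits n) _∷_ _ ⟨
    ∑ (elemsP n r) (λ c → ∑ (0 ∷ 1 ∷ []) (λ z → H (c ∷ʳ z)))
      ∎

  φ-factor : Carrier → ℕ → ℕ → ℕ → ℕ → Carrier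
  φ-factor Yₙ x z s t = if (x ≡ᵇ 1) ∧ (z ≡ᵇ 0) then 1# + - pow Yₙ (t ∸ s) else 1#

  -- The factor of phi contributed by last coordinates x, z after prefix sums s, t.
  φ-step : Carrier → ℕ → ℕ → ℕ → ℕ → Carrier
  φ-step Yₙ x z s t = [ (s ℕ.+ x) ≤ᵇ (t ℕ.+ z) ] φ-factor Yₙ x z s t

  leqTGo-snoc : ∀ sa sb (α γ : List ℕ) x z → length α ≡ length γ →
    leqTGo sa sb (α ∷ʳ x) (γ ∷ʳ z) ≡ (leqTGo sa sb α γ ∧ ((sa ℕ.+ sum α ℕ.+ x) ≤ᵇ (sb ℕ.+ sum γ ℕ.+ z)))
  leqTGo-snoc sa sb []      []      x z _ rewrite ℕₚ.+-identityʳ sa | ℕₚ.+-identityʳ sb = Boolₚ.∧-identityʳ _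
  leqTGo-snoc sa sb (a ∷ α) (b ∷ γ) x z e
    rewrite leqTGo-snoc (sa ℕ.+ a) (sb ℕ.+ b) α γ x z (ℕₚ.suc-injective e)
          | ℕₚ.+-assoc sa a (sum α) | ℕₚ.+-assoc sb b (sum γ) =
    ≡.sym (Boolₚ.∧-assoc (sa ℕ.+ a ≤ᵇ sb ℕ.+ b) (leqTGo (sa ℕ.+ a) (sb ℕ.+ b) α γ) _)

  phiGo-snoc : ∀ Y i sa sb (α γ : List ℕ) x z → length α ≡ length γ →
    phiGo Y i sa sb (α ∷ʳ x) (γ ∷ʳ z) ≈ phiGo Y i sa sb α γ * φ-factor (Y (i ℕ.+ length α)) x z (sa ℕ.+ sum α) (sb ℕ.+ sum γ)
  phiGo-snoc Y i sa sb []      []      x z _ rewrite ℕₚ.+-identityʳ sa | ℕₚ.+-identityʳ sb | ℕₚ.+-identityʳ i =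
    trans (*-identityʳ _) (sym (*-identityˡ _))
  phiGo-snoc Y i sa sb (a ∷ α) (b ∷ γ) x z e
    rewrite ℕₚ.+-suc i (length α) | ≡.sym (ℕₚ.+-assoc sa a (sum α)) | ≡.sym (ℕₚ.+-assoc sb b (sum γ)) =
    trans (*-congˡ (phiGo-snoc Y (suc i) (sa ℕ.+ a) (sb ℕ.+ b) α γ x z (ℕₚ.suc-injective e))) (sym (*-assoc _ _ _))

  w₁-snoc : ∀ Y a₀ α c₀ γ x z → length α ≡ length γ →
    w₁ Y (a₀ ∷ (α ∷ʳ x)) (c₀ ∷ (γ ∷ʳ z))
      ≈ w₁ Y (a₀ ∷ α) (c₀ ∷ γ) * φ-step (Y (suc (length α))) x z (a₀ ℕ.+ sum α) (c₀ ℕ.+ sum γ)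
  w₁-snoc Y a₀ α c₀ γ x z e = begin
    gauss (Y 0) c₀ a₀ * phi Y (a₀ ∷ (α ∷ʳ x)) (c₀ ∷ (γ ∷ʳ z))
      ≈⟨ *-congˡ (phi≈[leqT] Y a₀ (α ∷ʳ x) c₀ (γ ∷ʳ z)) ⟩
    gauss (Y 0) c₀ a₀ * [ (a₀ ≤ᵇ c₀) ∧ leqTGo a₀ c₀ (α ∷ʳ x) (γ ∷ʳ z) ] phiGo Y 1 a₀ c₀ (α ∷ʳ x) (γ ∷ʳ z)
      ≈⟨ *-congˡ (reflexive (≡.cong₂ [_]_ leqT-snoc ≡.refl)) ⟩
    gauss (Y 0) c₀ a₀ * [ leqT (a₀ ∷ α) (c₀ ∷ γ) ∧ lastOK ] phiGo Y 1 a₀ c₀ (α ∷ʳ x) (γ ∷ʳ z)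
      ≈⟨ *-congˡ ([]-cong _ (λ _ → phiGo-snoc Y 1 a₀ c₀ α γ x z e)) ⟩
    gauss (Y 0) c₀ a₀ * [ leqT (a₀ ∷ α) (c₀ ∷ γ) ∧ lastOK ] (phiGo Y 1 a₀ c₀ α γ * φ-factor Yₙ x z s t)
      ≈⟨ *-congˡ ([]-∧-* _ lastOK _ _) ⟩
    gauss (Y 0) c₀ a₀ * ([ leqT (a₀ ∷ α) (c₀ ∷ γ) ] phiGo Y 1 a₀ c₀ α γ * φ-step Yₙ x z s t)
      ≈⟨ *-congˡ (*-congʳ (phi≈[leqT] Y a₀ α c₀ γ)) ⟨
    gauss (Y 0) c₀ a₀ * (phi Y (a₀ ∷ α) (c₀ ∷ γ) * φ-step Yₙ x z s t)
      ≈⟨ *-assoc _ _ _ ⟨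
    w₁ Y (a₀ ∷ α) (c₀ ∷ γ) * φ-step Yₙ x z s t
      ∎
    where
    s = a₀ ℕ.+ sum α
    t = c₀ ℕ.+ sum γ
    Yₙ = Y (suc (length α))
    lastOK = (s ℕ.+ x) ≤ᵇ (t ℕ.+ z)
    leqT-snoc : (a₀ ≤ᵇ c₀) ∧ leqTGo a₀ c₀ (α ∷ʳ x) (γ ∷ʳ z) ≡ leqT (a₀ ∷ α) (c₀ ∷ γ) ∧ lastOK
    leqT-snoc rewrite leqTGo-snoc a₀ c₀ α γ x z e = ≡.sym (Boolₚ.∧-assoc (a₀ ≤ᵇ c₀) _ _)

  μTail-snoc : ∀ Y i s (γ : List ℕ) z → μTail Y i s (γ ∷ʳ z) ≈ μTail Y i s γ * pow (Y (i ℕ.+ length γ)) (s ℕ.+ sum γ)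
  μTail-snoc Y i s []      z rewrite ℕₚ.+-identityʳ i | ℕₚ.+-identityʳ s = trans (*-identityʳ _) (sym (*-identityˡ _))
  μTail-snoc Y i s (x ∷ γ) z rewrite ℕₚ.+-suc i (length γ) | ≡.sym (ℕₚ.+-assoc s x (sum γ)) =
    trans (*-congˡ (μTail-snoc Y (suc i) (s ℕ.+ x) γ z)) (sym (*-assoc _ _ _))

  μ₁-snoc : ∀ Y c₀ (γ : List ℕ) z →
    μ₁ Y (c₀ ∷ (γ ∷ʳ z)) ≈ μ₁ Y (c₀ ∷ γ) * (sgn z * pow (Y (suc (length γ))) (c₀ ℕ.+ sum γ))
  μ₁-snoc Y c₀ γ z = begin
    sgn (c₀ ℕ.+ sum (γ ∷ʳ z)) * (pow (Y 0) (c₀ C 2) * μTail Y 1 c₀ (γ ∷ʳ z))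
      ≈⟨ *-cong (reflexive (≡.cong sgn |c|≡)) (*-congˡ (μTail-snoc Y 1 c₀ γ z)) ⟩
    sgn (t ℕ.+ z) * (pow (Y 0) (c₀ C 2) * (μTail Y 1 c₀ γ * Q))
      ≈⟨ *-congʳ (sgn-+ t z) ⟩
    sgn t * sgn z * (pow (Y 0) (c₀ C 2) * (μTail Y 1 c₀ γ * Q))
      ≈⟨ solve 5 (λ s s′ p m q → s :* s′ :* (p :* (m :* q)) := s :* (p :* m) :* (s′ :* q)) refl
           (sgn t) (sgn z) (pow (Y 0) (c₀ C 2)) (μTail Y 1 c₀ γ) Q ⟩
    μ₁ Y (c₀ ∷ γ) * (sgn z * Q)
      ∎
    where
    t = c₀ ℕ.+ sum γ
    Q = pow (Y (suc (length γ))) t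
    |c|≡ : c₀ ℕ.+ sum (γ ∷ʳ z) ≡ t ℕ.+ z
    |c|≡ = ≡.trans (≡.cong (c₀ ℕ.+_) (≡.trans (sum-++ γ (z ∷ [])) (≡.cong (sum γ ℕ.+_) (ℕₚ.+-identityʳ z))))
                   (≡.sym (ℕₚ.+-assoc c₀ (sum γ) z))

  lastBitSum : Carrier → Carrier → ℕ → ℕ → ℕ → ℕ → ℕ → Carrier
  lastBitSum Yₙ Yₙ′ x x̄ s t u = ∑ (0 ∷ 1 ∷ []) (λ z → φ-step Yₙ′ x z s t * (sgn z * pow Yₙ t) * φ-step Yₙ z x̄ t u)

  lastBitValue : Carrier → ℕ → ℕ → ℕ → ℕ → Carrier
  lastBitValue Yₙ 0 0 s u = pow Yₙ u
  lastBitValue Yₙ 1 1 s u = - pow Yₙ s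
  lastBitValue Yₙ 1 0 s u = pow Yₙ u + - pow Yₙ s
  lastBitValue Yₙ _ _ s u = 0#

  module LastBit (Yₙ Yₙ′ : Carrier) (inverse : Yₙ * Yₙ′ ≈ 1#) where

    φ-step-10ˡ : ∀ {s t} → s ≤ t → φ-step Yₙ′ 1 0 s t * pow Yₙ t ≈ pow Yₙ t + - pow Yₙ s
    φ-step-10ˡ {s} {t} s≤t with ℕₚ.m≤n⇒m<n∨m≡n s≤t
    ... | inj₁ s<t = begin
      [ s ℕ.+ 1 ≤ᵇ t ℕ.+ 0 ] (1# + - pow Yₙ′ (t ∸ s)) * pow Yₙ t
        ≈⟨ *-congʳ ([]-true _ (≤⇒≤ᵇ (≡.subst₂ _≤_ (ℕₚ.+-comm 1 s) (≡.sym (ℕₚ.+-identityʳ t)) s<t))) ⟩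
      (1# + - pow Yₙ′ (t ∸ s)) * pow Yₙ t
        ≈⟨ *-congˡ (pow-∸ Yₙ s≤t) ⟨
      (1# + - pow Yₙ′ (t ∸ s)) * (pow Yₙ s * pow Yₙ (t ∸ s))
        ≈⟨ solve 3 (λ q p r → (𝟙 :- q) :* (p :* r) := p :* r :- p :* (r :* q)) refl
             (pow Yₙ′ (t ∸ s)) (pow Yₙ s) (pow Yₙ (t ∸ s)) ⟩
      pow Yₙ s * pow Yₙ (t ∸ s) + - (pow Yₙ s * (pow Yₙ (t ∸ s) * pow Yₙ′ (t ∸ s)))
        ≈⟨ +-cong (pow-∸ Yₙ s≤t) (-‿cong (trans (*-congˡ (pow-inverse (t ∸ s) inverse)) (*-identityʳ _))) ⟩
      pow Yₙ t + - pow Yₙ s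
        ∎
    ... | inj₂ ≡.refl = begin
      [ s ℕ.+ 1 ≤ᵇ s ℕ.+ 0 ] (1# + - pow Yₙ′ (s ∸ s)) * pow Yₙ s   ≈⟨ *-congʳ ([]-false _ (≰⇒≤ᵇ-false s+1≰s+0)) ⟩
      0# * pow Yₙ s                                                 ≈⟨ zeroˡ _ ⟩
      0#                                                            ≈⟨ -‿inverseʳ _ ⟨
      pow Yₙ s + - pow Yₙ s                                         ∎
      where
      s+1≰s+0 : ¬ (s ℕ.+ 1 ≤ s ℕ.+ 0)
      s+1≰s+0 = ℕₚ.<⇒≱ (ℕₚ.+-monoʳ-< s (s≤s z≤n))

    φ-step-10ʳ : ∀ {t u} → t ≤ u → pow Yₙ t * φ-step Yₙ 1 0 t u ≈ pow Yₙ t + - pow Yₙ u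
    φ-step-10ʳ {t} {u} t≤u with ℕₚ.m≤n⇒m<n∨m≡n t≤u
    ... | inj₁ t<u = begin
      pow Yₙ t * [ t ℕ.+ 1 ≤ᵇ u ℕ.+ 0 ] (1# + - pow Yₙ (u ∸ t))
        ≈⟨ *-congˡ ([]-true _ (≤⇒≤ᵇ (≡.subst₂ _≤_ (ℕₚ.+-comm 1 t) (≡.sym (ℕₚ.+-identityʳ u)) t<u))) ⟩
      pow Yₙ t * (1# + - pow Yₙ (u ∸ t))
        ≈⟨ solve 2 (λ p q → p :* (𝟙 :- q) := p :- p :* q) refl (pow Yₙ t) (pow Yₙ (u ∸ t)) ⟩
      pow Yₙ t + - (pow Yₙ t * pow Yₙ (u ∸ t))
        ≈⟨ +-congˡ (-‿cong (pow-∸ Yₙ t≤u)) ⟩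
      pow Yₙ t + - pow Yₙ u
        ∎
    ... | inj₂ ≡.refl = begin
      pow Yₙ t * [ t ℕ.+ 1 ≤ᵇ t ℕ.+ 0 ] (1# + - pow Yₙ (t ∸ t))   ≈⟨ *-congˡ ([]-false _ (≰⇒≤ᵇ-false t+1≰t+0)) ⟩
      pow Yₙ t * 0#                                                ≈⟨ zeroʳ _ ⟩
      0#                                                           ≈⟨ -‿inverseʳ _ ⟨
      pow Yₙ t + - pow Yₙ t                                        ∎
      where
      t+1≰t+0 : ¬ (t ℕ.+ 1 ≤ t ℕ.+ 0)
      t+1≰t+0 = ℕₚ.<⇒≱ (ℕₚ.+-monoʳ-< t (s≤s z≤n))

    φ-step-≤ : ∀ Y x z {s t} → s ℕ.+ x ≤ t ℕ.+ z → φ-step Y x z s t ≈ φ-factor Y x z s t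
    φ-step-≤ Y x z s+x≤t+z = []-true _ (≤⇒≤ᵇ s+x≤t+z)

    -- The sum over the last bit of the middle element does not depend on its prefix sum t.
    lastBitSum≈lastBitValue : ∀ x x̄ {s t u} → x ≤ 1 → x̄ ≤ 1 → s ≤ t → t ≤ u →
      lastBitSum Yₙ Yₙ′ x x̄ s t u ≈ lastBitValue Yₙ x x̄ s u
    lastBitSum≈lastBitValue 0 0 {s} {t} {u} _ _ s≤t t≤u = begin
      φ-step Yₙ′ 0 0 s t * (1# * pow Yₙ t) * φ-step Yₙ 0 0 t u
        + (φ-step Yₙ′ 0 1 s t * (- 1# * 1# * pow Yₙ t) * φ-step Yₙ 1 0 t u + 0#)
        ≈⟨ +-cong (*-cong (*-congʳ (φ-step-≤ Yₙ′ 0 0 (ℕₚ.+-monoˡ-≤ 0 s≤t))) (φ-step-≤ Yₙ 0 0 (ℕₚ.+-monoˡ-≤ 0 t≤u)))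
                  (+-congʳ (*-congʳ (*-congʳ (φ-step-≤ Yₙ′ 0 1 (ℕₚ.+-mono-≤ s≤t z≤n))))) ⟩
      1# * (1# * pow Yₙ t) * 1# + (1# * (- 1# * 1# * pow Yₙ t) * φ-step Yₙ 1 0 t u + 0#)
        ≈⟨ solve 2 (λ p e → 𝟙 :* (𝟙 :* p) :* 𝟙 :+ (𝟙 :* (:- 𝟙 :* 𝟙 :* p) :* e :+ 𝟘) := p :- p :* e) refl
             (pow Yₙ t) (φ-step Yₙ 1 0 t u) ⟩
      pow Yₙ t + - (pow Yₙ t * φ-step Yₙ 1 0 t u)
        ≈⟨ +-congˡ (-‿cong (φ-step-10ʳ t≤u)) ⟩
      pow Yₙ t + - (pow Yₙ t + - pow Yₙ u)
        ≈⟨ solve 2 (λ p q → p :- (p :- q) := q) refl (pow Yₙ t) (pow Yₙ u) ⟩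
      pow Yₙ u
        ∎
    lastBitSum≈lastBitValue 1 1 {s} {t} {u} _ _ s≤t t≤u = begin
      φ-step Yₙ′ 1 0 s t * (1# * pow Yₙ t) * φ-step Yₙ 0 1 t u
        + (φ-step Yₙ′ 1 1 s t * (- 1# * 1# * pow Yₙ t) * φ-step Yₙ 1 1 t u + 0#)
        ≈⟨ +-cong (*-congˡ (φ-step-≤ Yₙ 0 1 (ℕₚ.+-mono-≤ t≤u z≤n)))
                  (+-congʳ (*-cong (*-congʳ (φ-step-≤ Yₙ′ 1 1 (ℕₚ.+-monoˡ-≤ 1 s≤t)))
                                   (φ-step-≤ Yₙ 1 1 (ℕₚ.+-monoˡ-≤ 1 t≤u)))) ⟩
      φ-step Yₙ′ 1 0 s t * (1# * pow Yₙ t) * 1# + (1# * (- 1# * 1# * pow Yₙ t) * 1# + 0#)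
        ≈⟨ solve 2 (λ a p → a :* (𝟙 :* p) :* 𝟙 :+ (𝟙 :* (:- 𝟙 :* 𝟙 :* p) :* 𝟙 :+ 𝟘) := a :* p :- p) refl
             (φ-step Yₙ′ 1 0 s t) (pow Yₙ t) ⟩
      φ-step Yₙ′ 1 0 s t * pow Yₙ t + - pow Yₙ t
        ≈⟨ +-congʳ (φ-step-10ˡ s≤t) ⟩
      pow Yₙ t + - pow Yₙ s + - pow Yₙ t
        ≈⟨ solve 2 (λ p q → p :- q :- p := :- q) refl (pow Yₙ t) (pow Yₙ s) ⟩
      - pow Yₙ s
        ∎
    lastBitSum≈lastBitValue 0 1 {s} {t} {u} _ _ s≤t t≤u = begin
      φ-step Yₙ′ 0 0 s t * (1# * pow Yₙ t) * φ-step Yₙ 0 1 t u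
        + (φ-step Yₙ′ 0 1 s t * (- 1# * 1# * pow Yₙ t) * φ-step Yₙ 1 1 t u + 0#)
        ≈⟨ +-cong (*-cong (*-congʳ (φ-step-≤ Yₙ′ 0 0 (ℕₚ.+-monoˡ-≤ 0 s≤t)))
                          (φ-step-≤ Yₙ 0 1 (ℕₚ.+-mono-≤ t≤u z≤n)))
                  (+-congʳ (*-cong (*-congʳ (φ-step-≤ Yₙ′ 0 1 (ℕₚ.+-mono-≤ s≤t z≤n)))
                                   (φ-step-≤ Yₙ 1 1 (ℕₚ.+-monoˡ-≤ 1 t≤u)))) ⟩
      1# * (1# * pow Yₙ t) * 1# + (1# * (- 1# * 1# * pow Yₙ t) * 1# + 0#)
        ≈⟨ solve 1 (λ p → 𝟙 :* (𝟙 :* p) :* 𝟙 :+ (𝟙 :* (:- 𝟙 :* 𝟙 :* p) :* 𝟙 :+ 𝟘) := 𝟘) refl (pow Yₙ t) ⟩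
      0#
        ∎
    lastBitSum≈lastBitValue 1 0 {s} {t} {u} _ _ s≤t t≤u = begin
      φ-step Yₙ′ 1 0 s t * (1# * pow Yₙ t) * φ-step Yₙ 0 0 t u
        + (φ-step Yₙ′ 1 1 s t * (- 1# * 1# * pow Yₙ t) * φ-step Yₙ 1 0 t u + 0#)
        ≈⟨ +-cong (*-congˡ (φ-step-≤ Yₙ 0 0 (ℕₚ.+-monoˡ-≤ 0 t≤u)))
                  (+-congʳ (*-congʳ (*-congʳ (φ-step-≤ Yₙ′ 1 1 (ℕₚ.+-monoˡ-≤ 1 s≤t))))) ⟩
      φ-step Yₙ′ 1 0 s t * (1# * pow Yₙ t) * 1# + (1# * (- 1# * 1# * pow Yₙ t) * φ-step Yₙ 1 0 t u + 0#)
        ≈⟨ solve 3 (λ a p e → a :* (𝟙 :* p) :* 𝟙 :+ (𝟙 :* (:- 𝟙 :* 𝟙 :* p) :* e :+ 𝟘) := a :* p :- p :* e) refl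
             (φ-step Yₙ′ 1 0 s t) (pow Yₙ t) (φ-step Yₙ 1 0 t u) ⟩
      φ-step Yₙ′ 1 0 s t * pow Yₙ t + - (pow Yₙ t * φ-step Yₙ 1 0 t u)
        ≈⟨ +-cong (φ-step-10ˡ s≤t) (-‿cong (φ-step-10ʳ t≤u)) ⟩
      pow Yₙ t + - pow Yₙ s + - (pow Yₙ t + - pow Yₙ u)
        ≈⟨ solve 3 (λ p q r → p :- q :- (p :- r) := r :- q) refl (pow Yₙ t) (pow Yₙ s) (pow Yₙ u) ⟩
      pow Yₙ u + - pow Yₙ s
        ∎
    lastBitSum≈lastBitValue (suc (suc _)) _             (s≤s ()) _        _ _
    lastBitSum≈lastBitValue 0             (suc (suc _)) _        (s≤s ()) _ _
    lastBitSum≈lastBitValue 1             (suc (suc _)) _        (s≤s ()) _ _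

  w₁-single : ∀ Y a₀ c₀ → w₁ Y (a₀ ∷ []) (c₀ ∷ []) ≈ gauss (Y 0) c₀ a₀
  w₁-single Y a₀ c₀ with a₀ ≤ᵇ c₀ in e
  ... | true  = *-identityʳ _
  ... | false = trans (zeroʳ _) (sym (gauss-< (Y 0) (ℕₚ.≰⇒> (≤ᵇ-false⇒≰ {a₀} {c₀} e))))

  μ₁-single : ∀ Y c₀ → μ₁ Y (c₀ ∷ []) ≈ μ₀ (Y 0) c₀
  μ₁-single Y c₀ = *-cong (reflexive (≡.cong sgn (ℕₚ.+-identityʳ c₀))) (*-identityʳ _)

  module ComponentInversion (Y Y′ : ℕ → Carrier) where

    F : List ℕ → List ℕ → List ℕ → Carrier
    F a b c = w₁ Y′ a c * μ₁ Y c * w₁ Y c b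

    F-*-cong : ∀ a b c {x y} → (leqT a c ≡ true → leqT c b ≡ true → x ≈ y) → F a b c * x ≈ F a b c * y
    F-*-cong a b c {x} {y} x≈y = by-order (leqT a c) ≡.refl (leqT c b) ≡.refl
      where
      vanishing : F a b c ≈ 0# → F a b c * x ≈ F a b c * y
      vanishing F≈0 = trans (*-congʳ F≈0) (trans (zeroˡ _) (sym (trans (*-congʳ F≈0) (zeroˡ _))))
      by-order : ∀ b₁ → leqT a c ≡ b₁ → ∀ b₂ → leqT c b ≡ b₂ → F a b c * x ≈ F a b c * y
      by-order true  a≤c true  c≤b = *-congˡ (x≈y a≤c c≤b)
      by-order false a≰c _     _   = vanishing (trans (*-congʳ (trans (*-congʳ (w₁-≰ Y′ a c a≰c)) (zeroˡ _))) (zeroˡ _))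
      by-order true  _   false c≰b = vanishing (trans (*-congˡ (w₁-≰ Y c b c≰b)) (zeroʳ _))

    single-coordinate : ∀ r a₀ b₀ → Y 0 * Y′ 0 ≈ 1# → b₀ ≤ r →
      ∑ (elemsP 0 r) (F (a₀ ∷ []) (b₀ ∷ [])) ≈ [ eqL (a₀ ∷ []) (b₀ ∷ []) ] μ₁ Y (b₀ ∷ [])
    single-coordinate r a₀ b₀ inverse b₀≤r = begin
      ∑ (elemsP 0 r) (F (a₀ ∷ []) (b₀ ∷ []))
        ≈⟨ ∑-concatMap-map (upTo (suc r)) (λ _ → bits 0) _∷_ _ ⟩
      ∑ (upTo (suc r)) (λ c₀ → F (a₀ ∷ []) (b₀ ∷ []) (c₀ ∷ []) + 0#)
        ≈⟨ ∑-upTo (suc r) _ ⟩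
      ∑< (suc r) (λ c₀ → F (a₀ ∷ []) (b₀ ∷ []) (c₀ ∷ []) + 0#)
        ≈⟨ ∑<-cong (suc r) (λ c₀ → trans (+-identityʳ _)
             (*-cong (*-cong (w₁-single Y′ a₀ c₀) (μ₁-single Y c₀)) (w₁-single Y c₀ b₀))) ⟩
      GaussianInversion.E (Y 0) (Y′ 0) inverse (suc r) a₀ b₀
        ≈⟨ GaussianInversion.E-δ (Y 0) (Y′ 0) inverse b₀ a₀ (suc r) (s≤s b₀≤r) ⟩
      [ a₀ ≡ᵇ b₀ ] μ₀ (Y 0) b₀
        ≈⟨ []-cong (a₀ ≡ᵇ b₀) (λ _ → sym (μ₁-single Y b₀)) ⟩
      [ a₀ ≡ᵇ b₀ ] μ₁ Y (b₀ ∷ [])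
        ≡⟨ ≡.cong ([_] μ₁ Y (b₀ ∷ [])) (eqL-single a₀ b₀) ⟨
      [ eqL (a₀ ∷ []) (b₀ ∷ []) ] μ₁ Y (b₀ ∷ [])
        ∎

    F-snoc : ∀ {n} a₀ α x b₀ β x̄ c₀ γ z → length α ≡ n → length γ ≡ n → length β ≡ n →
      F (a₀ ∷ (α ∷ʳ x)) (b₀ ∷ (β ∷ʳ x̄)) (c₀ ∷ (γ ∷ʳ z)) ≈
        F (a₀ ∷ α) (b₀ ∷ β) (c₀ ∷ γ) *
          (φ-step (Y′ (suc n)) x z (a₀ ℕ.+ sum α) (c₀ ℕ.+ sum γ) * (sgn z * pow (Y (suc n)) (c₀ ℕ.+ sum γ))
           * φ-step (Y (suc n)) z x̄ (c₀ ℕ.+ sum γ) (b₀ ℕ.+ sum β))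
    F-snoc a₀ α x b₀ β x̄ c₀ γ z ≡.refl |γ|≡ |β|≡ = begin
      F (a₀ ∷ (α ∷ʳ x)) (b₀ ∷ (β ∷ʳ x̄)) (c₀ ∷ (γ ∷ʳ z))
        ≈⟨ *-cong (*-cong (w₁-snoc Y′ a₀ α c₀ γ x z (≡.sym |γ|≡)) μ-snoc) w-snoc ⟩
      w₁ Y′ (a₀ ∷ α) (c₀ ∷ γ) * E₁ * (μ₁ Y (c₀ ∷ γ) * (sgn z * Q)) * (w₁ Y (c₀ ∷ γ) (b₀ ∷ β) * E₂)
        ≈⟨ solve 7 (λ A e₁ M s q B e₂ → A :* e₁ :* (M :* (s :* q)) :* (B :* e₂) := A :* M :* B :* (e₁ :* (s :* q) :* e₂)) refl
             (w₁ Y′ (a₀ ∷ α) (c₀ ∷ γ)) E₁ (μ₁ Y (c₀ ∷ γ)) (sgn z) Q (w₁ Y (c₀ ∷ γ) (b₀ ∷ β)) E₂ ⟩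
      F (a₀ ∷ α) (b₀ ∷ β) (c₀ ∷ γ) * (E₁ * (sgn z * Q) * E₂)
        ∎
      where
      n  = length α
      t  = c₀ ℕ.+ sum γ
      E₁ = φ-step (Y′ (suc n)) x z (a₀ ℕ.+ sum α) t
      Q  = pow (Y (suc n)) t
      E₂ = φ-step (Y (suc n)) z x̄ t (b₀ ℕ.+ sum β)
      μ-snoc : μ₁ Y (c₀ ∷ (γ ∷ʳ z)) ≈ μ₁ Y (c₀ ∷ γ) * (sgn z * Q)
      μ-snoc = ≡.subst (λ k → μ₁ Y (c₀ ∷ (γ ∷ʳ z)) ≈ μ₁ Y (c₀ ∷ γ) * (sgn z * pow (Y (suc k)) t))
                       |γ|≡ (μ₁-snoc Y c₀ γ z)
      w-snoc : w₁ Y (c₀ ∷ (γ ∷ʳ z)) (b₀ ∷ (β ∷ʳ x̄)) ≈ w₁ Y (c₀ ∷ γ) (b₀ ∷ β) * E₂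
      w-snoc = ≡.subst (λ k → w₁ Y (c₀ ∷ (γ ∷ʳ z)) (b₀ ∷ (β ∷ʳ x̄))
                                ≈ w₁ Y (c₀ ∷ γ) (b₀ ∷ β) * φ-step (Y (suc k)) z x̄ t (b₀ ℕ.+ sum β))
                       |γ|≡ (w₁-snoc Y c₀ γ b₀ β z x̄ (≡.trans |γ|≡ (≡.sym |β|≡)))

    ∑-last-bit : ∀ n r a₀ α x b₀ β x̄ → Y (suc n) * Y′ (suc n) ≈ 1# →
      BitString n α → BitString n β → x ≤ 1 → x̄ ≤ 1 → ∀ c → c ∈ elemsP n r →
      ∑ (0 ∷ 1 ∷ []) (λ z → F (a₀ ∷ (α ∷ʳ x)) (b₀ ∷ (β ∷ʳ x̄)) (c ∷ʳ z))
        ≈ F (a₀ ∷ α) (b₀ ∷ β) c * lastBitValue (Y (suc n)) x x̄ (a₀ ℕ.+ sum α) (b₀ ℕ.+ sum β)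
    ∑-last-bit n r a₀ α x b₀ β x̄ inverse α∈ β∈ x≤1 x̄≤1 c c∈ with ∈-elemsP⁻ n r c∈
    ... | _∷_ {c₀} {γ} _ γ∈ = begin
      ∑ (0 ∷ 1 ∷ []) (λ z → F (a₀ ∷ (α ∷ʳ x)) (b₀ ∷ (β ∷ʳ x̄)) (c₀ ∷ (γ ∷ʳ z)))
        ≈⟨ ∑-cong (0 ∷ 1 ∷ []) (λ z → F-snoc a₀ α x b₀ β x̄ c₀ γ z
             (BitString-length α∈) (BitString-length γ∈) (BitString-length β∈)) ⟩
      ∑ (0 ∷ 1 ∷ []) (λ z → F (a₀ ∷ α) (b₀ ∷ β) (c₀ ∷ γ) * summand z)
        ≈⟨ ∑-*ˡ (0 ∷ 1 ∷ []) (F (a₀ ∷ α) (b₀ ∷ β) (c₀ ∷ γ)) summand ⟩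
      F (a₀ ∷ α) (b₀ ∷ β) (c₀ ∷ γ) * lastBitSum Yₙ Yₙ′ x x̄ s t u
        ≈⟨ F-*-cong (a₀ ∷ α) (b₀ ∷ β) (c₀ ∷ γ) (λ a≤c c≤b →
             LastBit.lastBitSum≈lastBitValue Yₙ Yₙ′ inverse x x̄ x≤1 x̄≤1
               (leqT⇒sum≤ (a₀ ∷ α) (c₀ ∷ γ) a≤c) (leqT⇒sum≤ (c₀ ∷ γ) (b₀ ∷ β) c≤b)) ⟩
      F (a₀ ∷ α) (b₀ ∷ β) (c₀ ∷ γ) * lastBitValue Yₙ x x̄ s u
        ∎
      where
      Yₙ  = Y (suc n)
      Yₙ′ = Y′ (suc n)
      s = a₀ ℕ.+ sum α
      t = c₀ ℕ.+ sum γ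
      u = b₀ ℕ.+ sum β
      summand : ℕ → Carrier
      summand z = φ-step Yₙ′ x z s t * (sgn z * pow Yₙ t) * φ-step Yₙ z x̄ t u

    δ-snoc : ∀ Yₙ a₀ α x b₀ β x̄ → x ≤ 1 → x̄ ≤ 1 →
      [ eqL (a₀ ∷ α) (b₀ ∷ β) ] μ₁ Y (b₀ ∷ β) * lastBitValue Yₙ x x̄ (a₀ ℕ.+ sum α) (b₀ ℕ.+ sum β)
        ≈ [ eqL (a₀ ∷ (α ∷ʳ x)) (b₀ ∷ (β ∷ʳ x̄)) ] (μ₁ Y (b₀ ∷ β) * (sgn x̄ * pow Yₙ (b₀ ℕ.+ sum β)))
    δ-snoc Yₙ a₀ α x b₀ β x̄ x≤1 x̄≤1 with (a₀ ∷ α) ≟L (b₀ ∷ β)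
    ... | no a≢b rewrite ≢⇒eqL-false a≢b
                       | ≢⇒eqL-false {a₀ ∷ (α ∷ʳ x)} {b₀ ∷ (β ∷ʳ x̄)}
                           (λ e → a≢b (≡.cong₂ _∷_ (proj₁ (Listₚ.∷-injective e))
                                                   (Listₚ.∷ʳ-injectiveˡ α β (proj₂ (Listₚ.∷-injective e)))))
                       = zeroˡ _
    ... | yes ≡.refl rewrite ≡⇒eqL {a₀ ∷ α} ≡.refl = by-bits x x̄ x≤1 x̄≤1
      where
      M = μ₁ Y (a₀ ∷ α)
      s = a₀ ℕ.+ sum α
      ≢-last : ∀ {x x̄} → x ≢ x̄ → eqL (a₀ ∷ (α ∷ʳ x)) (a₀ ∷ (α ∷ʳ x̄)) ≡ false
      ≢-last {x} {x̄} x≢x̄ = ≢⇒eqL-false {a₀ ∷ (α ∷ʳ x)} {a₀ ∷ (α ∷ʳ x̄)}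
                             (λ e → x≢x̄ (Listₚ.∷ʳ-injectiveʳ α α (proj₂ (Listₚ.∷-injective e))))
      by-bits : ∀ x x̄ → x ≤ 1 → x̄ ≤ 1 →
        M * lastBitValue Yₙ x x̄ s s ≈ [ eqL (a₀ ∷ (α ∷ʳ x)) (a₀ ∷ (α ∷ʳ x̄)) ] (M * (sgn x̄ * pow Yₙ s))
      by-bits 0 0 _ _ rewrite ≡⇒eqL {a₀ ∷ (α ∷ʳ 0)} ≡.refl = *-congˡ (sym (*-identityˡ _))
      by-bits 1 1 _ _ rewrite ≡⇒eqL {a₀ ∷ (α ∷ʳ 1)} ≡.refl =
        solve 2 (λ m p → m :* (:- p) := m :* (:- 𝟙 :* 𝟙 :* p)) refl M (pow Yₙ s)
      by-bits 0 1 _ _ rewrite ≢-last {0} {1} (λ ()) = zeroʳ _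
      by-bits 1 0 _ _ rewrite ≢-last {1} {0} (λ ()) = trans (*-congˡ (-‿inverseʳ _)) (zeroʳ _)
      by-bits (suc (suc _)) _             (s≤s ()) _
      by-bits 0             (suc (suc _)) _        (s≤s ())
      by-bits 1             (suc (suc _)) _        (s≤s ())

    component-inversion : ∀ n r a b → (∀ j → j ≤ n → Y j * Y′ j ≈ 1#) → InP n r a → InP n r b →
      ∑ (elemsP n r) (F a b) ≈ [ eqL a b ] μ₁ Y b
    component-inversion zero r (a₀ ∷ []) (b₀ ∷ []) inverse (_ ∷ []) (b₀≤r ∷ []) =
      single-coordinate r a₀ b₀ (inverse 0 z≤n) b₀≤r
    component-inversion (suc m) r (a₀ ∷ _) (b₀ ∷ _) inverse (a₀≤r ∷ α∈) (b₀≤r ∷ β∈)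
      with snocView α∈ | snocView β∈
    ... | snoc {α} {x} ≡.refl α′∈ x≤1 | snoc {β} {x̄} ≡.refl β′∈ x̄≤1 = begin
      ∑ (elemsP (suc m) r) (F a b)
        ≈⟨ ∑-elemsP-snoc m r (F a b) ⟩
      ∑ (elemsP m r) (λ c → ∑ (0 ∷ 1 ∷ []) (λ z → F a b (c ∷ʳ z)))
        ≈⟨ ∑-cong∈ (elemsP m r) (∑-last-bit m r a₀ α x b₀ β x̄ (inverse (suc m) ℕₚ.≤-refl) α′∈ β′∈ x≤1 x̄≤1) ⟩
      ∑ (elemsP m r) (λ c → F a′ b′ c * lastBitValue Yₙ x x̄ s u)
        ≈⟨ ∑-*ʳ (elemsP m r) _ (F a′ b′) ⟩
      ∑ (elemsP m r) (F a′ b′) * lastBitValue Yₙ x x̄ s u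
        ≈⟨ *-congʳ (component-inversion m r a′ b′ (λ j j≤m → inverse j (ℕₚ.m≤n⇒m≤1+n j≤m))
                                        (a₀≤r ∷ α′∈) (b₀≤r ∷ β′∈)) ⟩
      [ eqL a′ b′ ] μ₁ Y b′ * lastBitValue Yₙ x x̄ s u
        ≈⟨ δ-snoc Yₙ a₀ α x b₀ β x̄ x≤1 x̄≤1 ⟩
      [ eqL a b ] (μ₁ Y b′ * (sgn x̄ * pow Yₙ u))
        ≈⟨ []-cong (eqL a b) (λ _ → sym (≡.subst (λ k → μ₁ Y b ≈ μ₁ Y b′ * (sgn x̄ * pow (Y (suc k)) u))
                                              (BitString-length β′∈) (μ₁-snoc Y b₀ β x̄))) ⟩
      [ eqL a b ] μ₁ Y b
        ∎
      where
      a  = a₀ ∷ (α ∷ʳ x)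
      b  = b₀ ∷ (β ∷ʳ x̄)
      a′ = a₀ ∷ α
      b′ = b₀ ∷ β
      s  = a₀ ℕ.+ sum α
      u  = b₀ ℕ.+ sum β
      Yₙ = Y (suc m)

  -- Products over the components

  ∏w₁ : ∀ {g} → (Fin g → ℕ → Carrier) → Vec (List ℕ) g → Vec (List ℕ) g → Carrier
  ∏w₁ y []       []       = 1#
  ∏w₁ y (a ∷ as) (b ∷ bs) = w₁ (y Fin.zero) a b * ∏w₁ (λ i → y (Fin.suc i)) as bs

  μ : ∀ {g} → (Fin g → ℕ → Carrier) → Vec (List ℕ) g → Carrier
  μ y []       = 1#
  μ y (a ∷ as) = μ₁ (y Fin.zero) a * μ (λ i → y (Fin.suc i)) as

  Kᵢ : (ℕ → Carrier) → ℕ → ℕ → Carrier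
  Kᵢ Y n r = pow (Y 0) (r C 2) * foldr _*_ 1# (map (λ j → pow (Y j) (r ℕ.+ j ∸ 1)) (applyUpTo suc n))

  ∏K : ∀ {g} → Vec ℕ g → Vec ℕ g → (Fin g → ℕ → Carrier) → Carrier
  ∏K []       []       y = 1#
  ∏K (n ∷ ns) (r ∷ rs) y = Kᵢ (y Fin.zero) n r * ∏K ns rs (λ i → y (Fin.suc i))

  -- w and K recurse through helpers local to their definitions; w-go and K-go
  -- are these helpers, recovered by unification against one unfolding step.
  mutual
    w-go : ∀ {g m} (y : Fin g → ℕ → Carrier) (a b : Vec (List ℕ) g) →
      Vec (Fin g) m → Vec (List ℕ) m → Vec (List ℕ) m → Carrier
    w-go = _

    private
      w-unfold : ∀ {g} (y : Fin (suc g) → ℕ → Carrier) a as b bs →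
        w y (a ∷ as) (b ∷ bs) ≈
          theta (y (id Fin.zero) 0) a b * phi (y (id Fin.zero)) a b *
          w-go y (a ∷ as) (b ∷ bs) (tabulate (λ k → id (Fin.suc k))) as bs
      w-unfold {g} y a as b bs with suc g | y | Fin.zero {g} | a ∷ as | b ∷ bs | tabulate {n = g} (λ k → id (Fin.suc k))
      ... | _ | _ | _ | _ | _ | _ = refl

  mutual
    K-go : ∀ {g m} (ns rs : Vec ℕ g) (y : Fin g → ℕ → Carrier) → Vec (Fin g) m → Vec ℕ m → Vec ℕ m → Carrier
    K-go = _

    private
      K-unfold : ∀ {g} (y : Fin (suc g) → ℕ → Carrier) n ns r rs →
        K (n ∷ ns) (r ∷ rs) y ≈
          pow (y (id Fin.zero) 0) (r C 2) * foldr _*_ 1# (map (λ j → pow (y (id Fin.zero) j) (r ℕ.+ j ∸ 1)) (applyUpTo suc n)) *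
          K-go (n ∷ ns) (r ∷ rs) y (tabulate (λ k → id (Fin.suc k))) ns rs
      K-unfold {g} y n ns r rs with suc g | y | Fin.zero {g} | n ∷ ns | r ∷ rs | tabulate {n = g} (λ k → id (Fin.suc k))
      ... | _ | _ | _ | _ | _ | _ = refl

  w≈∏w₁ : ∀ {g} (y : Fin g → ℕ → Carrier) a b → w y a b ≈ ∏w₁ y a b
  w≈∏w₁ y a b = go (λ i → i) a b
    where
    go : ∀ {m} (f : Fin m → Fin _) as bs → w-go y a b (tabulate f) as bs ≈ ∏w₁ (λ i → y (f i)) as bs
    go f []       []       = refl
    go f (_ ∷ as) (_ ∷ bs) = *-congˡ (go (λ i → f (Fin.suc i)) as bs)

  K≈∏K : ∀ {g} (ns rs : Vec ℕ g) (y : Fin g → ℕ → Carrier) → K ns rs y ≈ ∏K ns rs y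
  K≈∏K ns rs y = go (λ i → i) ns rs
    where
    go : ∀ {m} (f : Fin m → Fin _) ns′ rs′ → K-go ns rs y (tabulate f) ns′ rs′ ≈ ∏K ns′ rs′ (λ i → y (f i))
    go f []       []       = refl
    go f (_ ∷ ns′) (_ ∷ rs′) = *-congˡ (go (λ i → f (Fin.suc i)) ns′ rs′)

  ∏w₁-diag : ∀ {g} (y : Fin g → ℕ → Carrier) a → ∏w₁ y a a ≈ 1#
  ∏w₁-diag y []       = refl
  ∏w₁-diag y (a ∷ as) = trans (*-cong (w₁-diag (y Fin.zero) a) (∏w₁-diag (λ i → y (Fin.suc i)) as)) (*-identityˡ _)

  ∏w₁-≰ : ∀ {g} (y : Fin g → ℕ → Carrier) a b → leqP a b ≡ false → ∏w₁ y a b ≈ 0#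
  ∏w₁-≰ y []       []       ()
  ∏w₁-≰ y (a ∷ as) (b ∷ bs) a≰b = by-head (leqT a b) ≡.refl
    where
    by-head : ∀ b₀ → leqT a b ≡ b₀ → ∏w₁ y (a ∷ as) (b ∷ bs) ≈ 0#
    by-head false a₀≰b₀ = trans (*-congʳ (w₁-≰ (y Fin.zero) a b a₀≰b₀)) (zeroˡ _)
    by-head true  a₀≤b₀ =
      trans (*-congˡ (∏w₁-≰ (λ i → y (Fin.suc i)) as bs (≡.subst (λ t → t ∧ leqP as bs ≡ false) a₀≤b₀ a≰b))) (zeroʳ _)

  w-diag : ∀ {g} (y : Fin g → ℕ → Carrier) a → w y a a ≈ 1#
  w-diag y a = trans (w≈∏w₁ y a a) (∏w₁-diag y a)

  w-≰ : ∀ {g} (y : Fin g → ℕ → Carrier) a b → leqP a b ≡ false → w y a b ≈ 0#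
  w-≰ y a b a≰b = trans (w≈∏w₁ y a b) (∏w₁-≰ y a b a≰b)

  ∑-bits-δ : ∀ {n π} → BitString n π → (H : List ℕ → Carrier) → ∑ (bits n) (λ γ → [ eqL γ π ] H γ) ≈ H π
  ∑-bits-δ []                       H = +-identityʳ _
  ∑-bits-δ {suc n} (_∷_ {x = x} {α = π} x≤1 π∈) H = begin
    ∑ (bits (suc n)) (λ γ → [ eqL γ (x ∷ π) ] H γ)
      ≈⟨ ∑-concatMap-map (0 ∷ 1 ∷ []) (λ _ → bits n) _∷_ _ ⟩
    ∑ (0 ∷ 1 ∷ []) (λ b → ∑ (bits n) (λ γ → [ (b ≡ᵇ x) ∧ eqL γ π ] H (b ∷ γ)))
      ≈⟨ ∑∑-[∧] (0 ∷ 1 ∷ []) (bits n) (_≡ᵇ x) (λ γ → eqL γ π) (λ b γ → H (b ∷ γ)) ⟩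
    ∑ (0 ∷ 1 ∷ []) (λ b → [ b ≡ᵇ x ] ∑ (bits n) (λ γ → [ eqL γ π ] H (b ∷ γ)))
      ≈⟨ ∑-cong (0 ∷ 1 ∷ []) (λ b → []-cong (b ≡ᵇ x) (λ _ → ∑-bits-δ π∈ (λ γ → H (b ∷ γ)))) ⟩
    ∑ (0 ∷ 1 ∷ []) (λ b → [ b ≡ᵇ x ] H (b ∷ π))
      ≈⟨ ∑<-δ 2 x (λ b → H (b ∷ π)) (s≤s x≤1) ⟩
    H (x ∷ π)
      ∎

  ∑-elemsP-δ : ∀ {n r p} → InP n r p → (G : List ℕ → Carrier) → ∑ (elemsP n r) (λ a → [ eqL a p ] G a) ≈ G p
  ∑-elemsP-δ {n} {r} (_∷_ {q₀} {π} q₀≤r π∈) G = begin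
    ∑ (elemsP n r) (λ a → [ eqL a (q₀ ∷ π) ] G a)
      ≈⟨ ∑-concatMap-map (upTo (suc r)) (λ _ → bits n) _∷_ _ ⟩
    ∑ (upTo (suc r)) (λ a₀ → ∑ (bits n) (λ γ → [ (a₀ ≡ᵇ q₀) ∧ eqL γ π ] G (a₀ ∷ γ)))
      ≈⟨ ∑∑-[∧] (upTo (suc r)) (bits n) (_≡ᵇ q₀) (λ γ → eqL γ π) (λ a₀ γ → G (a₀ ∷ γ)) ⟩
    ∑ (upTo (suc r)) (λ a₀ → [ a₀ ≡ᵇ q₀ ] ∑ (bits n) (λ γ → [ eqL γ π ] G (a₀ ∷ γ)))
      ≈⟨ ∑-cong (upTo (suc r)) (λ a₀ → []-cong (a₀ ≡ᵇ q₀) (λ _ → ∑-bits-δ π∈ (λ γ → G (a₀ ∷ γ)))) ⟩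
    ∑ (upTo (suc r)) (λ a₀ → [ a₀ ≡ᵇ q₀ ] G (a₀ ∷ π))
      ≈⟨ ∑-upTo (suc r) _ ⟩
    ∑< (suc r) (λ a₀ → [ a₀ ≡ᵇ q₀ ] G (a₀ ∷ π))
      ≈⟨ ∑<-δ (suc r) q₀ (λ a₀ → G (a₀ ∷ π)) (s≤s q₀≤r) ⟩
    G (q₀ ∷ π)
      ∎

  ∑-allP-δ : ∀ {g} {ns rs : Vec ℕ g} {p} → InPs ns rs p → (F : Vec (List ℕ) g → Carrier) →
    ∑ (allP ns rs) (λ c → [ eqP c p ] F c) ≈ F p
  ∑-allP-δ []                                     F = +-identityʳ _
  ∑-allP-δ {ns = n ∷ ns} {r ∷ rs} (_∷_ {a = p₀} {as = ps} p₀∈ ps∈) F = begin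
    ∑ (allP (n ∷ ns) (r ∷ rs)) (λ c → [ eqP c (p₀ ∷ ps) ] F c)
      ≈⟨ ∑-concatMap-map (elemsP n r) (λ _ → allP ns rs) _∷_ _ ⟩
    ∑ (elemsP n r) (λ a → ∑ (allP ns rs) (λ as → [ eqL a p₀ ∧ eqP as ps ] F (a ∷ as)))
      ≈⟨ ∑∑-[∧] (elemsP n r) (allP ns rs) (λ a → eqL a p₀) (λ as → eqP as ps) (λ a as → F (a ∷ as)) ⟩
    ∑ (elemsP n r) (λ a → [ eqL a p₀ ] ∑ (allP ns rs) (λ as → [ eqP as ps ] F (a ∷ as)))
      ≈⟨ ∑-cong (elemsP n r) (λ a → []-cong (eqL a p₀) (λ _ → ∑-allP-δ ps∈ (λ as → F (a ∷ as)))) ⟩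
    ∑ (elemsP n r) (λ a → [ eqL a p₀ ] F (a ∷ ps))
      ≈⟨ ∑-elemsP-δ p₀∈ (λ a → F (a ∷ ps)) ⟩
    F (p₀ ∷ ps)
      ∎

  inversion : ∀ {g} (ns rs : Vec ℕ g) (y y′ : Fin g → ℕ → Carrier) →
    (∀ i j → j ≤ lookup ns i → y i j * y′ i j ≈ 1#) →
    ∀ {p b} → InPs ns rs p → InPs ns rs b →
    ∑ (allP ns rs) (λ c → w y′ p c * μ y c * w y c b) ≈ [ eqP p b ] μ y b
  inversion ns rs y y′ inverse {p} {b} p∈ b∈ =
    trans (∑-cong (allP ns rs) (λ c → *-cong (*-congʳ (w≈∏w₁ y′ p c)) (w≈∏w₁ y c b)))
          (∏-inversion ns rs y y′ inverse p∈ b∈)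
    where
    ∏-inversion : ∀ {g} (ns rs : Vec ℕ g) (y y′ : Fin g → ℕ → Carrier) →
      (∀ i j → j ≤ lookup ns i → y i j * y′ i j ≈ 1#) →
      ∀ {p b} → InPs ns rs p → InPs ns rs b →
      ∑ (allP ns rs) (λ c → ∏w₁ y′ p c * μ y c * ∏w₁ y c b) ≈ [ eqP p b ] μ y b
    ∏-inversion [] [] y y′ inverse [] [] = solve 0 (𝟙 :* 𝟙 :* 𝟙 :+ 𝟘 := 𝟙) refl
    ∏-inversion (n ∷ ns) (r ∷ rs) y y′ inverse {p₀ ∷ ps} {b₀ ∷ bs} (p₀∈ ∷ ps∈) (b₀∈ ∷ bs∈) = begin
      ∑ (allP (n ∷ ns) (r ∷ rs)) (λ c → ∏w₁ y′ (p₀ ∷ ps) c * μ y c * ∏w₁ y c (b₀ ∷ bs))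
        ≈⟨ ∑-concatMap-map (elemsP n r) (λ _ → allP ns rs) _∷_ _ ⟩
      ∑ (elemsP n r) (λ a → ∑ (allP ns rs) (λ as →
        ∏w₁ y′ (p₀ ∷ ps) (a ∷ as) * μ y (a ∷ as) * ∏w₁ y (a ∷ as) (b₀ ∷ bs)))
        ≈⟨ ∑-cong (elemsP n r) (λ a → ∑-cong (allP ns rs) (λ as →
             solve 6 (λ A B C D E G → A :* B :* (C :* D) :* (E :* G) := A :* C :* E :* (B :* D :* G)) refl
               (w₁ (y′ Fin.zero) p₀ a) (∏w₁ y₁′ ps as) (μ₁ (y Fin.zero) a) (μ y₁ as)
               (w₁ (y Fin.zero) a b₀) (∏w₁ y₁ as bs))) ⟩
      ∑ (elemsP n r) (λ a → ∑ (allP ns rs) (λ as → F₀ p₀ b₀ a * (∏w₁ y₁′ ps as * μ y₁ as * ∏w₁ y₁ as bs)))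
        ≈⟨ ∑-*-∑ (elemsP n r) (allP ns rs) _ _ ⟩
      ∑ (elemsP n r) (F₀ p₀ b₀) * ∑ (allP ns rs) (λ as → ∏w₁ y₁′ ps as * μ y₁ as * ∏w₁ y₁ as bs)
        ≈⟨ *-cong (ComponentInversion.component-inversion (y Fin.zero) (y′ Fin.zero) n r p₀ b₀ (inverse Fin.zero) p₀∈ b₀∈)
                  (∏-inversion ns rs y₁ y₁′ (λ i → inverse (Fin.suc i)) ps∈ bs∈) ⟩
      [ eqL p₀ b₀ ] μ₁ (y Fin.zero) b₀ * [ eqP ps bs ] μ y₁ bs
        ≈⟨ []-∧-* (eqL p₀ b₀) (eqP ps bs) _ _ ⟨
      [ eqP (p₀ ∷ ps) (b₀ ∷ bs) ] μ y (b₀ ∷ bs)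
        ∎
      where
      y₁ y₁′ : Fin _ → ℕ → Carrier
      y₁  i = y (Fin.suc i)
      y₁′ i = y′ (Fin.suc i)
      F₀ = ComponentInversion.F (y Fin.zero) (y′ Fin.zero)

  module IntervalInversion {g} (ns rs : Vec ℕ g) (y y′ : Fin g → ℕ → Carrier)
                           (inverse : ∀ i j → j ≤ lookup ns i → y i j * y′ i j ≈ 1#) where

    F : Vec (List ℕ) g → Vec (List ℕ) g → Vec (List ℕ) g → Carrier
    F p b c = w y′ p c * μ y c * w y c b

    split : ∀ p b → ltP p b ≡ true → ∀ c →
      F p b c ≈ [ ltP p c ∧ ltP c b ] F p b c + ([ eqP c p ] F p b c + [ eqP c b ] F p b c)
    split p b p<b c = by-cases (c ≟P p) (c ≟P b)
      where
      by-cases : Dec (c ≡ p) → Dec (c ≡ b) →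
        F p b c ≈ [ ltP p c ∧ ltP c b ] F p b c + ([ eqP c p ] F p b c + [ eqP c b ] F p b c)
      by-cases (yes ≡.refl) _ rewrite ltP-irrefl p | ≡⇒eqP {a = p} ≡.refl | ≢⇒eqP-false (ltP⇒≢ p b p<b) =
        sym (trans (+-identityˡ _) (+-identityʳ _))
      by-cases (no c≢p) (yes ≡.refl) rewrite p<b | ltP-irrefl b | ≢⇒eqP-false c≢p | ≡⇒eqP {a = b} ≡.refl =
        sym (trans (+-identityˡ _) (+-identityˡ _))
      by-cases (no c≢p) (no c≢b) = trans (by-order (leqP p c) ≡.refl (leqP c b) ≡.refl)
        (+-congˡ (sym (+-cong ([]-false _ (≢⇒eqP-false c≢p)) ([]-false _ (≢⇒eqP-false c≢b)))))
        where
        vanishing : F p b c ≈ 0# → F p b c ≈ [ ltP p c ∧ ltP c b ] F p b c + (0# + 0#)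
        vanishing F≈0 = trans F≈0 (sym (trans (+-congʳ (trans ([]-cong (ltP p c ∧ ltP c b) (λ _ → F≈0)) ([]-0# _)))
                                              (trans (+-identityˡ _) (+-identityˡ _))))
        by-order : ∀ b₁ → leqP p c ≡ b₁ → ∀ b₂ → leqP c b ≡ b₂ → F p b c ≈ [ ltP p c ∧ ltP c b ] F p b c + (0# + 0#)
        by-order true  p≤c true  c≤b = sym (trans (+-congˡ (+-identityˡ _)) (trans (+-identityʳ _)
          ([]-true _ (∧-true (leqP∧≢⇒ltP p≤c (λ e → c≢p (≡.sym e))) (leqP∧≢⇒ltP c≤b c≢b)))))
        by-order false p≰c _     _   = vanishing (trans (*-congʳ (trans (*-congʳ (w-≰ y′ p c p≰c)) (zeroˡ _))) (zeroˡ _))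
        by-order true  _   false c≰b = vanishing (trans (*-congˡ (w-≰ y c b c≰b)) (zeroʳ _))

    interval-inversion : ∀ {p b} → InPs ns rs p → InPs ns rs b → ltP p b ≡ true →
      ∑ (allP ns rs) (λ c → [ ltP p c ∧ ltP c b ] F p b c) ≈ - (μ y p * w y p b) + - (w y′ p b * μ y b)
    interval-inversion {p} {b} p∈ b∈ p<b = begin
      X                            ≈⟨ solve 3 (λ x a b → x := (x :+ (a :+ b)) :+ (:- a :+ :- b)) refl X Fp Fb ⟩
      (X + (Fp + Fb)) + (- Fp + - Fb) ≈⟨ +-congʳ total ⟩
      0# + (- Fp + - Fb)              ≈⟨ +-identityˡ _ ⟩
      - Fp + - Fb                     ≈⟨ +-cong (-‿cong (trans (*-congʳ (trans (*-congʳ (w-diag y′ p)) (*-identityˡ _))) refl))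
                                                (-‿cong (trans (*-congˡ (w-diag y b)) (*-identityʳ _))) ⟩
      - (μ y p * w y p b) + - (w y′ p b * μ y b)
        ∎
      where
      X  = ∑ (allP ns rs) (λ c → [ ltP p c ∧ ltP c b ] F p b c)
      Fp = F p b p
      Fb = F p b b
      total : X + (Fp + Fb) ≈ 0#
      total = begin
        X + (Fp + Fb)
          ≈⟨ +-congˡ (+-cong (∑-allP-δ p∈ (F p b)) (∑-allP-δ b∈ (F p b))) ⟨
        X + (∑ (allP ns rs) (λ c → [ eqP c p ] F p b c) + ∑ (allP ns rs) (λ c → [ eqP c b ] F p b c))
          ≈⟨ trans (∑-+ (allP ns rs) _ _) (+-congˡ (∑-+ (allP ns rs) _ _)) ⟨
        ∑ (allP ns rs) (λ c → [ ltP p c ∧ ltP c b ] F p b c + ([ eqP c p ] F p b c + [ eqP c b ] F p b c))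
          ≈⟨ ∑-cong (allP ns rs) (split p b p<b) ⟨
        ∑ (allP ns rs) (F p b)
          ≈⟨ inversion ns rs y y′ inverse p∈ b∈ ⟩
        [ eqP p b ] μ y b
          ≈⟨ []-false _ (≢⇒eqP-false (ltP⇒≢ p b p<b)) ⟩
        0#
          ∎

  module ChainSums {g} (ns rs : Vec ℕ g) where

    P : List (Vec (List ℕ) g)
    P = allP ns rs

    1̂ : Vec (List ℕ) g
    1̂ = top ns rs

    inside : Vec (List ℕ) g → Vec (List ℕ) g → Bool
    inside p c = ltP p c ∧ ltP c 1̂

    mutual
      -- S Q Y f p sums W_C ∏ Q over the chains p < c₁ < … < c_k < 1̂ with k ≤ f.
      S : (Vec (List ℕ) g → Carrier) → (Fin g → ℕ → Carrier) → ℕ → Vec (List ℕ) g → Carrier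
      S Q Y zero    p = w Y p 1̂
      S Q Y (suc f) p = w Y p 1̂ + S-tail Q Y f p

      S-tail : (Vec (List ℕ) g → Carrier) → (Fin g → ℕ → Carrier) → ℕ → Vec (List ℕ) g → Carrier
      S-tail Q Y f p = ∑ P (λ c → [ inside p c ] (w Y p c * Q c * S Q Y f c))

    chainsAbove≈S : ∀ Q Y f p → foldr _+_ 0# (map (chainTerm Y Q 1̂ p) (chainsAbove ns rs f p)) ≈ S Q Y f p
    chainsAbove≈S Q Y zero    p = +-identityʳ _
    chainsAbove≈S Q Y (suc f) p = +-congˡ (begin
      foldr _+_ 0# (map (chainTerm Y Q 1̂ p) (concatMap (λ c → map (c ∷_) (chainsAbove ns rs f c)) (filterᵇ (inside p) P)))
        ≈⟨ foldr-map≈∑ (concatMap (λ c → map (c ∷_) (chainsAbove ns rs f c)) (filterᵇ (inside p) P)) (chainTerm Y Q 1̂ p) ⟩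
      ∑ (concatMap (λ c → map (c ∷_) (chainsAbove ns rs f c)) (filterᵇ (inside p) P)) (chainTerm Y Q 1̂ p)
        ≈⟨ ∑-concatMap-map (filterᵇ (inside p) P) (λ c → chainsAbove ns rs f c) _∷_ _ ⟩
      ∑ (filterᵇ (inside p) P) (λ c → ∑ (chainsAbove ns rs f c) (λ cs → w Y p c * Q c * chainTerm Y Q 1̂ c cs))
        ≈⟨ ∑-cong (filterᵇ (inside p) P) (λ c → trans (∑-*ˡ (chainsAbove ns rs f c) (w Y p c * Q c) (chainTerm Y Q 1̂ c))
             (*-congˡ (trans (sym (foldr-map≈∑ (chainsAbove ns rs f c) (chainTerm Y Q 1̂ c))) (chainsAbove≈S Q Y f c)))) ⟩
      ∑ (filterᵇ (inside p) P) (λ c → w Y p c * Q c * S Q Y f c)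
        ≈⟨ ∑-filterᵇ P (inside p) _ ⟩
      S-tail Q Y f p
        ∎)
      where
      ∑-filterᵇ : ∀ xs (b : Vec (List ℕ) g → Bool) (F : Vec (List ℕ) g → Carrier) →
        ∑ (filterᵇ b xs) F ≈ ∑ xs (λ x → [ b x ] F x)
      ∑-filterᵇ []       b F = refl
      ∑-filterᵇ (x ∷ xs) b F with b x
      ... | true  = +-congˡ (∑-filterᵇ xs b F)
      ... | false = trans (∑-filterᵇ xs b F) (sym (+-identityˡ _))

    height : Vec (List ℕ) g → ℕ
    height p = length (filterᵇ (ltP p) P)

    height-< : ∀ p {c} → c ∈ P → ltP p c ≡ true → height c < height p
    height-< p {c} c∈ p<c = length-filterᵇ-< (ltP c) (ltP p) (λ d c<d → ltP-trans p c d p<c c<d) c∈ p<c (ltP-irrefl c)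

    height-inside : ∀ p {c f} → height p ≤ suc f → c ∈ P → inside p c ≡ true → height c ≤ f
    height-inside p p≤1+f c∈ p<c<1̂ = ℕₚ.≤-pred (ℕₚ.<-≤-trans (height-< p c∈ (∧-trueˡ p<c<1̂)) p≤1+f)

    S-stable : ∀ Q Y f p → height p ≤ f → S Q Y (suc f) p ≈ S Q Y f p
    S-stable Q Y zero    p h≤0 = trans (+-congˡ (∑-zero∈ P nothing-inside)) (+-identityʳ _)
      where
      nothing-inside : ∀ c → c ∈ P → [ inside p c ] (w Y p c * Q c * S Q Y 0 c) ≈ 0#
      nothing-inside c c∈ with ltP p c in p<c
      ... | true  = ⊥-elim (ℕₚ.n≮0 (ℕₚ.<-≤-trans (height-< p c∈ p<c) h≤0))
      ... | false = refl
    S-stable Q Y (suc f) p h≤1+f = +-congˡ (∑-cong∈ P (λ c c∈ →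
      []-cong (inside p c) (λ p<c<1̂ → *-congˡ (S-stable Q Y f c (height-inside p h≤1+f c∈ p<c<1̂)))))

  module ChainReciprocity {g} (ns rs : Vec ℕ g) (y y′ : Fin g → ℕ → Carrier)
                          (inverse : ∀ i j → j ≤ lookup ns i → y i j * y′ i j ≈ 1#)
                          (q q′ : Vec (List ℕ) g → Carrier)
                          (q′≈ : ∀ c → c ∈ allP ns rs → inOpen ns rs c ≡ true → q′ c ≈ - (1# + q c))
                          (U : Carrier) (Uμ1̂≈1 : U * μ y (top ns rs) ≈ 1#) where

    open ChainSums ns rs
    open IntervalInversion ns rs y y′ inverse

    inside-inOpen : ∀ p {c} → InPs ns rs p → inside p c ≡ true → inOpen ns rs c ≡ true
    inside-inOpen p {c} p∈ p<c<1̂ =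
      ∧-true (leqP-ltP-trans (bot ns) p c (bot-leqP p∈) (∧-trueˡ p<c<1̂)) (∧-trueʳ {ltP p c} p<c<1̂)

    Σμ : ℕ → Vec (List ℕ) g → Carrier
    Σμ f p = ∑ P (λ d → [ inside p d ] (w y′ p d * q d * μ y d * S q y f d))

    expand-S : ∀ f p c →
      w y′ p c * μ y c * S q y (suc f) c ≈ F p 1̂ c + ∑ P (λ d → [ inside c d ] (F p d c * (q d * S q y f d)))
    expand-S f p c = trans (distribˡ _ _ _) (+-congˡ (trans (sym (∑-*ˡ P _ _)) (∑-cong P (λ d →
      trans (sym ([]-*ˡ (inside c d) _ _)) ([]-cong (inside c d) (λ _ →
        solve 5 (λ a m b r s → a :* m :* (b :* r :* s) := a :* m :* b :* (r :* s)) refl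
          (w y′ p c) (μ y c) (w y c d) (q d) (S q y f d)))))))

    ∑-inside-inside : ∀ f {p} → InPs ns rs p →
      ∑ P (λ c → [ inside p c ] ∑ P (λ d → [ inside c d ] (F p d c * (q d * S q y f d))))
        ≈ - (μ y p * S-tail q y f p) + - Σμ f p
    ∑-inside-inside f {p} p∈ = begin
      ∑ P (λ c → [ inside p c ] ∑ P (λ d → [ inside c d ] Φ c d))
        ≈⟨ ∑-cong P (λ c → []-∑ (inside p c) P _) ⟩
      ∑ P (λ c → ∑ P (λ d → [ inside p c ] ([ inside c d ] Φ c d)))
        ≈⟨ ∑-swap P P _ ⟩
      ∑ P (λ d → ∑ P (λ c → [ inside p c ] ([ inside c d ] Φ c d)))
        ≈⟨ ∑-cong P (λ d → trans (∑-cong P (λ c → reorder c d)) (sym ([]-∑ (inside p d) P _))) ⟩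
      ∑ P (λ d → [ inside p d ] ∑ P (λ c → [ ltP p c ∧ ltP c d ] Φ c d))
        ≈⟨ ∑-cong∈ P (λ d d∈ → []-cong (inside p d) (λ p<d<1̂ →
             trans (∑-cong P (λ c → []-*ʳ (ltP p c ∧ ltP c d) (marked-tail d) (F p d c)))
               (trans (∑-*ʳ P (marked-tail d) _) (*-congʳ (interval-inversion p∈ (∈-allP⁻ ns rs d∈) (∧-trueˡ p<d<1̂)))))) ⟩
      ∑ P (λ d → [ inside p d ] ((- (μ y p * w y p d) + - (w y′ p d * μ y d)) * marked-tail d))
        ≈⟨ ∑-cong P (λ d → trans ([]-cong (inside p d) (λ _ →
             solve 6 (λ m a b t r s → (:- (m :* a) :+ :- (b :* t)) :* (r :* s) := :- (m :* (a :* r :* s)) :+ :- (b :* r :* t :* s))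
               refl (μ y p) (w y p d) (w y′ p d) (μ y d) (q d) (S q y f d)))
             (trans ([]-+ (inside p d) _ _) (+-cong (trans ([]-neg (inside p d) _) (-‿cong ([]-*ˡ (inside p d) (μ y p) _)))
                                                    ([]-neg (inside p d) _)))) ⟩
      ∑ P (λ d → - (μ y p * [ inside p d ] (w y p d * q d * S q y f d)) + - [ inside p d ] (w y′ p d * q d * μ y d * S q y f d))
        ≈⟨ trans (∑-+ P _ _) (+-cong (trans (∑-neg P _) (-‿cong (∑-*ˡ P (μ y p) _))) (∑-neg P _)) ⟩
      - (μ y p * S-tail q y f p) + - Σμ f p
        ∎
      where
      marked-tail : Vec (List ℕ) g → Carrier
      marked-tail d = q d * S q y f d
      Φ : Vec (List ℕ) g → Vec (List ℕ) g → Carrier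
      Φ c d = F p d c * marked-tail d
      reorder : ∀ c d → [ inside p c ] ([ inside c d ] Φ c d) ≈ [ inside p d ] ([ ltP p c ∧ ltP c d ] Φ c d)
      reorder c d = begin
        [ inside p c ] ([ inside c d ] Φ c d)       ≈⟨ []-∧ (inside p c) _ _ ⟨
        [ inside p c ∧ inside c d ] Φ c d           ≡⟨ ≡.cong ([_] Φ c d) (∧-chain (ltP p c) (ltP c 1̂) (ltP c d) (ltP d 1̂) (ltP p d)
                                                         (ltP-trans p c d) (ltP-trans c d 1̂)) ⟩
        [ inside p d ∧ (ltP p c ∧ ltP c d) ] Φ c d  ≈⟨ []-∧ (inside p d) _ _ ⟩
        [ inside p d ] ([ ltP p c ∧ ltP c d ] Φ c d) ∎

    ∑-μS : ∀ f {p} → InPs ns rs p → ltP p 1̂ ≡ true →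
      ∑ P (λ c → [ inside p c ] (w y′ p c * μ y c * S q y (suc f) c))
        ≈ (- (μ y p * w y p 1̂) + - (w y′ p 1̂ * μ y 1̂)) + (- (μ y p * S-tail q y f p) + - Σμ f p)
    ∑-μS f {p} p∈ p<1̂ = begin
      ∑ P (λ c → [ inside p c ] (w y′ p c * μ y c * S q y (suc f) c))
        ≈⟨ ∑-cong P (λ c → trans ([]-cong (inside p c) (λ _ → expand-S f p c)) ([]-+ (inside p c) _ _)) ⟩
      ∑ P (λ c → [ inside p c ] F p 1̂ c + [ inside p c ] ∑ P (λ d → [ inside c d ] (F p d c * (q d * S q y f d))))
        ≈⟨ ∑-+ P _ _ ⟩
      ∑ P (λ c → [ inside p c ] F p 1̂ c) + ∑ P (λ c → [ inside p c ] ∑ P (λ d → [ inside c d ] (F p d c * (q d * S q y f d))))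
        ≈⟨ +-cong (interval-inversion p∈ (top∈ ns rs) p<1̂) (∑-inside-inside f p∈) ⟩
      (- (μ y p * w y p 1̂) + - (w y′ p 1̂ * μ y 1̂)) + (- (μ y p * S-tail q y f p) + - Σμ f p)
        ∎

    reciprocity-step : ∀ f {p} → InPs ns rs p → ltP p 1̂ ≡ true → height p ≤ suc f →
      (∀ c → c ∈ P → inside p c ≡ true → S q′ y′ f c ≈ - (U * μ y c) * S q y f c) →
      S q′ y′ (suc f) p ≈ - (U * μ y p) * S q y (suc f) p
    reciprocity-step f {p} p∈ p<1̂ h≤1+f IH = begin
      w y′ p 1̂ + ∑ P (λ c → [ inside p c ] (w y′ p c * q′ c * S q′ y′ f c))
        ≈⟨ +-congˡ (∑-cong∈ P (λ c c∈ → trans ([]-cong (inside p c) (λ p<c<1̂ → marked c c∈ p<c<1̂))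
             (trans ([]-+ (inside p c) _ _) (+-cong ([]-*ˡ (inside p c) U _) ([]-*ˡ (inside p c) U _))))) ⟩
      w y′ p 1̂ + ∑ P (λ c → U * [ inside p c ] X₁ c + U * [ inside p c ] X₂ c)
        ≈⟨ +-congˡ (trans (∑-+ P _ _) (+-cong (∑-*ˡ P U _) (∑-*ˡ P U _))) ⟩
      w y′ p 1̂ + (U * ∑ P (λ c → [ inside p c ] X₁ c) + U * ∑ P (λ c → [ inside p c ] X₂ c))
        ≈⟨ +-congˡ (+-cong (*-congˡ (∑-μS f p∈ p<1̂)) (*-congˡ ∑X₂≈Σμ)) ⟩
      w y′ p 1̂ + (U * ((- (μ y p * w y p 1̂) + - (w y′ p 1̂ * μ y 1̂)) + (- (μ y p * τ) + - Σμ f p)) + U * Σμ f p)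
        ≈⟨ solve 7 (λ a u m b t s z → a :+ (u :* ((:- (m :* b) :+ :- (a :* t)) :+ (:- (m :* s) :+ :- z)) :+ u :* z)
                                      := :- (u :* m) :* (b :+ s) :+ a :* (𝟙 :- u :* t)) refl
             (w y′ p 1̂) U (μ y p) (w y p 1̂) (μ y 1̂) τ (Σμ f p) ⟩
      - (U * μ y p) * (w y p 1̂ + τ) + w y′ p 1̂ * (1# + - (U * μ y 1̂))
        ≈⟨ +-congˡ (trans (*-congˡ (trans (+-congˡ (-‿cong Uμ1̂≈1)) (-‿inverseʳ 1#))) (zeroʳ _)) ⟩
      - (U * μ y p) * S q y (suc f) p + 0#
        ≈⟨ +-identityʳ _ ⟩
      - (U * μ y p) * S q y (suc f) p
        ∎
      where
      τ = S-tail q y f p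
      X₁ X₂ : Vec (List ℕ) g → Carrier
      X₁ c = w y′ p c * μ y c * S q y (suc f) c
      X₂ c = w y′ p c * q c * μ y c * S q y (suc f) c

      -- By induction S′(c) = -Uμ(c) S(c), and the mark -(1 + q c) splits the term in two.
      marked : ∀ c → c ∈ P → inside p c ≡ true → w y′ p c * q′ c * S q′ y′ f c ≈ U * X₁ c + U * X₂ c
      marked c c∈ p<c<1̂ = begin
        w y′ p c * q′ c * S q′ y′ f c
          ≈⟨ *-cong (*-congˡ (q′≈ c c∈ (inside-inOpen p p∈ p<c<1̂)))
                    (trans (IH c c∈ p<c<1̂) (*-congˡ (sym (S-stable q y f c (height-inside p h≤1+f c∈ p<c<1̂))))) ⟩
        w y′ p c * - (1# + q c) * (- (U * μ y c) * S q y (suc f) c)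
          ≈⟨ solve 5 (λ a b u m s → a :* :- (𝟙 :+ b) :* (:- (u :* m) :* s) := u :* (a :* m :* s) :+ u :* (a :* b :* m :* s)) refl
               (w y′ p c) (q c) U (μ y c) (S q y (suc f) c) ⟩
        U * X₁ c + U * X₂ c
          ∎

      ∑X₂≈Σμ : ∑ P (λ c → [ inside p c ] X₂ c) ≈ Σμ f p
      ∑X₂≈Σμ = ∑-cong∈ P (λ c c∈ → []-cong (inside p c) (λ p<c<1̂ →
        *-congˡ (S-stable q y f c (height-inside p h≤1+f c∈ p<c<1̂))))

    reciprocity : ∀ f {p} → InPs ns rs p → ltP p 1̂ ≡ true → height p ≤ f → S q′ y′ f p ≈ - (U * μ y p) * S q y f p
    reciprocity zero    {p} p∈ p<1̂ h≤0 with () ← ℕₚ.<-≤-trans (height-< p (∈-allP⁺ (top∈ ns rs)) p<1̂) h≤0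
    reciprocity (suc f) {p} p∈ p<1̂ h≤1+f = reciprocity-step f p∈ p<1̂ h≤1+f (λ c c∈ p<c<1̂ →
      reciprocity f (∈-allP⁻ ns rs c∈) (∧-trueʳ {ltP p c} p<c<1̂) (height-inside p h≤1+f c∈ p<c<1̂))

  μTail-zeros : ∀ Y i n → μTail Y i 0 (replicate n 0) ≈ 1#
  μTail-zeros Y i zero    = refl
  μTail-zeros Y i (suc n) = trans (*-identityˡ _) (μTail-zeros Y (suc i) n)

  μ-bot : ∀ {g} (ns : Vec ℕ g) (y : Fin g → ℕ → Carrier) → μ y (bot ns) ≈ 1#
  μ-bot []       y = refl
  μ-bot (n ∷ ns) y = begin
    sgn (sum (replicate n 0)) * (1# * μTail (y Fin.zero) 1 0 (replicate n 0)) * μ (λ i → y (Fin.suc i)) (bot ns)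
      ≈⟨ *-cong (*-cong (reflexive (≡.cong sgn (≡.trans (sum-replicate n 0) (ℕₚ.*-zeroʳ n))))
                        (trans (*-identityˡ _) (μTail-zeros (y Fin.zero) 1 n)))
                (μ-bot ns (λ i → y (Fin.suc i))) ⟩
    1# * 1# * 1#
      ≈⟨ trans (*-identityʳ _) (*-identityʳ _) ⟩
    1#
      ∎

  -- At the top element (r, 1, …, 1) the prefix sums are s_j = r + j - 1, the exponents of K.
  μTail-ones-K : ∀ (Y Y′ : ℕ → Carrier) r n i s (f : ℕ → ℕ) → (∀ k → f k ≡ i ℕ.+ k) → r ℕ.+ i ∸ 1 ≡ s → 1 ≤ i →
    (∀ k → k < n → Y (i ℕ.+ k) * Y′ (i ℕ.+ k) ≈ 1#) →
    μTail Y i s (replicate n 1) * foldr _*_ 1# (map (λ j → pow (Y′ j) (r ℕ.+ j ∸ 1)) (applyUpTo f n)) ≈ 1#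
  μTail-ones-K Y Y′ r zero    i s f f≡ s≡ 1≤i inverse = *-identityˡ _
  μTail-ones-K Y Y′ r (suc n) i s f f≡ s≡ 1≤i inverse = begin
    pow (Y i) s * M * (pow (Y′ (f 0)) (r ℕ.+ f 0 ∸ 1) * Rest)
      ≈⟨ *-congˡ (*-congʳ (reflexive (≡.cong₂ pow (≡.cong Y′ f0≡i)
                                                    (≡.trans (≡.cong (λ z → r ℕ.+ z ∸ 1) f0≡i) s≡)))) ⟩
    pow (Y i) s * M * (pow (Y′ i) s * Rest)
      ≈⟨ solve 4 (λ a m b r′ → a :* m :* (b :* r′) := (a :* b) :* (m :* r′)) refl (pow (Y i) s) M (pow (Y′ i) s) Rest ⟩
    (pow (Y i) s * pow (Y′ i) s) * (M * Rest)
      ≈⟨ *-cong (pow-inverse s (≡.subst (λ z → Y z * Y′ z ≈ 1#) (ℕₚ.+-identityʳ i) (inverse 0 (s≤s z≤n))))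
                (μTail-ones-K Y Y′ r n (suc i) (s ℕ.+ 1) (λ k → f (suc k)) f≡′ s≡′ (s≤s z≤n) inverse′) ⟩
    1# * 1#
      ≈⟨ *-identityʳ _ ⟩
    1#
      ∎
    where
    M    = μTail Y (suc i) (s ℕ.+ 1) (replicate n 1)
    Rest = foldr _*_ 1# (map (λ j → pow (Y′ j) (r ℕ.+ j ∸ 1)) (applyUpTo (λ k → f (suc k)) n))
    f0≡i : f 0 ≡ i
    f0≡i = ≡.trans (f≡ 0) (ℕₚ.+-identityʳ i)
    f≡′ : ∀ k → f (suc k) ≡ suc i ℕ.+ k
    f≡′ k = ≡.trans (f≡ (suc k)) (ℕₚ.+-suc i k)
    s≡′ : r ℕ.+ suc i ∸ 1 ≡ s ℕ.+ 1
    s≡′ = ≡.trans (≡.cong (_∸ 1) (ℕₚ.+-suc r i))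
                  (≡.trans (≡.sym (ℕₚ.m∸n+n≡m (ℕₚ.≤-trans 1≤i (ℕₚ.m≤n+m i r)))) (≡.cong (ℕ._+ 1) s≡))
    inverse′ : ∀ k → k < n → Y (suc i ℕ.+ k) * Y′ (suc i ℕ.+ k) ≈ 1#
    inverse′ k k<n = ≡.subst (λ z → Y z * Y′ z ≈ 1#) (ℕₚ.+-suc i k) (inverse (suc k) (s≤s k<n))

  K-μ-top : ∀ {g} (ns rs : Vec ℕ g) (y y′ : Fin g → ℕ → Carrier) → (∀ i j → j ≤ lookup ns i → y i j * y′ i j ≈ 1#) →
    K ns rs y′ * μ y (top ns rs) ≈ sgn (bigN ns rs)
  K-μ-top ns rs y y′ inverse = trans (*-congʳ (K≈∏K ns rs y′)) (∏K-μ-top ns rs y y′ inverse)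
    where
    ∏K-μ-top : ∀ {g} (ns rs : Vec ℕ g) (y y′ : Fin g → ℕ → Carrier) → (∀ i j → j ≤ lookup ns i → y i j * y′ i j ≈ 1#) →
      ∏K ns rs y′ * μ y (top ns rs) ≈ sgn (bigN ns rs)
    ∏K-μ-top []       []       y y′ inverse = *-identityˡ _
    ∏K-μ-top (n ∷ ns) (r ∷ rs) y y′ inverse = begin
      pow (Y′ 0) (r C 2) * ∏Y′ * ∏K ns rs y₁′ * (sgn |top| * (pow (Y 0) (r C 2) * ∏Y) * μ y₁ (top ns rs))
        ≈⟨ solve 7 (λ a b k s c m u → a :* b :* k :* (s :* (c :* m) :* u) := s :* ((c :* a) :* (m :* b)) :* (k :* u)) refl
             (pow (Y′ 0) (r C 2)) ∏Y′ (∏K ns rs y₁′) (sgn |top|) (pow (Y 0) (r C 2)) ∏Y (μ y₁ (top ns rs)) ⟩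
      sgn |top| * ((pow (Y 0) (r C 2) * pow (Y′ 0) (r C 2)) * (∏Y * ∏Y′)) * (∏K ns rs y₁′ * μ y₁ (top ns rs))
        ≈⟨ *-cong (*-congˡ (*-cong (pow-inverse (r C 2) (inverse Fin.zero 0 z≤n))
                                   (μTail-ones-K Y Y′ r n 1 r suc (λ _ → ≡.refl) (ℕₚ.m+n∸n≡m r 1) (s≤s z≤n)
                                      (λ k k<n → inverse Fin.zero (suc k) k<n))))
                  (∏K-μ-top ns rs y₁ y₁′ (λ i → inverse (Fin.suc i))) ⟩
      sgn |top| * (1# * 1#) * sgn (bigN ns rs)
        ≈⟨ *-congʳ (trans (*-congˡ (*-identityʳ _)) (*-identityʳ _)) ⟩
      sgn |top| * sgn (bigN ns rs)
        ≈⟨ sgn-+ |top| (bigN ns rs) ⟨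
      sgn (|top| ℕ.+ bigN ns rs)
        ≡⟨ ≡.cong (λ z → sgn (z ℕ.+ bigN ns rs))
             (≡.trans (≡.cong (r ℕ.+_) (≡.trans (sum-replicate n 1) (ℕₚ.*-identityʳ n))) (ℕₚ.+-comm r n)) ⟩
      sgn (n ℕ.+ r ℕ.+ bigN ns rs)
        ∎
      where
      Y Y′ : ℕ → Carrier
      Y  = y Fin.zero
      Y′ = y′ Fin.zero
      y₁ y₁′ : Fin _ → ℕ → Carrier
      y₁  i = y (Fin.suc i)
      y₁′ i = y′ (Fin.suc i)
      |top| = r ℕ.+ sum (replicate n 1)
      ∏Y  = μTail Y 1 r (replicate n 1)
      ∏Y′ = foldr _*_ 1# (map (λ j → pow (Y′ j) (r ℕ.+ j ∸ 1)) (applyUpTo suc n))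

  -- X⁻¹/(1 - X⁻¹) = -(1 + X/(1 - X)).
  inverted-mark : ∀ {a a′ b b′} → a * a′ ≈ 1# → (1# + - a) * b ≈ 1# → (1# + - a′) * b′ ≈ 1# → a′ * b′ ≈ - (1# + a * b)
  inverted-mark {a} {a′} {b} {b′} aa′≈1 [1-a]b≈1 [1-a′]b′≈1 = begin
    a′ * b′
      ≈⟨ trans (*-congˡ [1-a]b≈1) (*-identityʳ _) ⟨
    a′ * b′ * ((1# + - a) * b)
      ≈⟨ solve 4 (λ a a′ b b′ → a′ :* b′ :* ((𝟙 :- a) :* b)
                                := :- ((𝟙 :- a′) :* b′) :* b :+ (𝟙 :- a :* a′) :* b′ :* b) refl a a′ b b′ ⟩
    - ((1# + - a′) * b′) * b + (1# + - (a * a′)) * b′ * b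
      ≈⟨ +-cong (*-congʳ (-‿cong [1-a′]b′≈1)) (*-congʳ (*-congʳ (+-congˡ (-‿cong aa′≈1)))) ⟩
    - 1# * b + (1# + - 1#) * b′ * b
      ≈⟨ solve 3 (λ a b b′ → :- 𝟙 :* b :+ (𝟙 :- 𝟙) :* b′ :* b := :- ((𝟙 :- a) :* b :+ a :* b)) refl a b b′ ⟩
    - ((1# + - a) * b + a * b)
      ≈⟨ -‿cong (+-congʳ [1-a]b≈1) ⟩
    - (1# + a * b)
      ∎

  S-top : ∀ {g} (ns rs : Vec ℕ g) Q Y f → ChainSums.S ns rs Q Y f (top ns rs) ≈ 1#
  S-top ns rs Q Y zero    = w-diag Y (top ns rs)
  S-top ns rs Q Y (suc f) = trans (+-cong (w-diag Y (top ns rs)) (∑-zero (allP ns rs) nothing-inside)) (+-identityʳ 1#)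
    where
    open ChainSums ns rs
    nothing-inside : ∀ c → [ inside 1̂ c ] (w Y 1̂ c * Q c * S Q Y f c) ≈ 0#
    nothing-inside c with ltP 1̂ c in 1̂<c
    ... | false = refl
    ... | true rewrite ltP-asym 1̂ c 1̂<c = refl

  HLS-trivial : ∀ {g} (ns rs : Vec ℕ g) → bot ns ≡ top ns rs → ∀ Y Q → HLS ns rs Y Q ≈ 1#
  HLS-trivial ns rs 0̂≡1̂ Y Q = trans (chainsAbove≈S Q Y (length P) (bot ns))
    (≡.subst (λ p → S Q Y (length P) p ≈ 1#) (≡.sym 0̂≡1̂) (S-top ns rs Q Y (length P)))
    where open ChainSums ns rs

  K-trivial : ∀ {g} (ns rs : Vec ℕ g) (y y′ : Fin g → ℕ → Carrier) →
    (∀ i j → j ≤ lookup ns i → y i j * y′ i j ≈ 1#) → bigN ns rs ≡ 0 → K ns rs y′ ≈ 1#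
  K-trivial ns rs y y′ inverse N≡0 = begin
    K ns rs y′                     ≈⟨ *-identityʳ _ ⟨
    K ns rs y′ * 1#                ≈⟨ *-congˡ (≡.subst (λ p → μ y p ≈ 1#) (bigN≡0⇒bot≡top ns rs N≡0) (μ-bot ns y)) ⟨
    K ns rs y′ * μ y (top ns rs)   ≈⟨ K-μ-top ns rs y y′ inverse ⟩
    sgn (bigN ns rs)               ≡⟨ ≡.cong sgn N≡0 ⟩
    1#                             ∎

  HLS-reciprocity : ∀ {g} (ns rs : Vec ℕ g) (y y′ : Fin g → ℕ → Carrier) →
    (∀ i j → j ≤ lookup ns i → y i j * y′ i j ≈ 1#) →
    (q q′ : Vec (List ℕ) g → Carrier) → (∀ c → c ∈ allP ns rs → inOpen ns rs c ≡ true → q′ c ≈ - (1# + q c)) →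
    HLS ns rs y′ q′ ≈ sign (bigN ns rs) * (K ns rs y′ * HLS ns rs y q)
  HLS-reciprocity ns rs y y′ inverse q q′ q′≈ with bigN ns rs in N≡
  ... | zero = begin
    HLS ns rs y′ q′                   ≈⟨ HLS-trivial ns rs 0̂≡1̂ y′ q′ ⟩
    1#                                ≈⟨ trans (*-identityˡ _) (trans (*-cong (K-trivial ns rs y y′ inverse N≡)
                                                                              (HLS-trivial ns rs 0̂≡1̂ y q))
                                                                      (*-identityˡ _)) ⟨
    1# * (K ns rs y′ * HLS ns rs y q) ∎
    where
    0̂≡1̂ = bigN≡0⇒bot≡top ns rs N≡
  ... | suc N = begin
    HLS ns rs y′ q′
      ≈⟨ chainsAbove≈S q′ y′ (length P) 0̂ ⟩
    S q′ y′ (length P) 0̂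
      ≈⟨ ChainReciprocity.reciprocity ns rs y y′ inverse q q′ q′≈ U Uμ1̂≈1
           (length P) (bot∈ ns rs) 0̂<1̂ (Listₚ.length-filter _ P) ⟩
    - (U * μ y 0̂) * S q y (length P) 0̂
      ≈⟨ *-cong (-‿cong (sym (trans (*-congˡ (μ-bot ns y)) (*-identityʳ U)))) (chainsAbove≈S q y (length P) 0̂) ⟨
    - (sgn (suc N) * K ns rs y′) * HLS ns rs y q
      ≈⟨ solve 3 (λ s k h → :- ((:- 𝟙 :* s) :* k) :* h := s :* (k :* h)) refl (sgn N) (K ns rs y′) (HLS ns rs y q) ⟩
    sgn N * (K ns rs y′ * HLS ns rs y q)
      ∎
    where
    open ChainSums ns rs
    0̂ = bot ns
    U = sgn (suc N) * K ns rs y′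
    Uμ1̂≈1 : U * μ y 1̂ ≈ 1#
    Uμ1̂≈1 = begin
      sgn (suc N) * K ns rs y′ * μ y 1̂     ≈⟨ *-assoc _ _ _ ⟩
      sgn (suc N) * (K ns rs y′ * μ y 1̂)   ≈⟨ *-congˡ (trans (K-μ-top ns rs y y′ inverse) (reflexive (≡.cong sgn N≡))) ⟩
      sgn (suc N) * sgn (suc N)            ≈⟨ sgn-sq (suc N) ⟩
      1#                                   ∎
    0̂<1̂ : ltP 0̂ 1̂ ≡ true
    0̂<1̂ = leqP∧≢⇒ltP (bot-leqP (top∈ ns rs))
                       (λ 0̂≡1̂ → ℕₚ.0≢1+n (≡.trans (≡.sym (bot≡top⇒bigN≡0 ns rs 0̂≡1̂)) N≡))

theorem3p14 : ∀ {c ℓ : Level} (R : CommutativeRing c ℓ) →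
    let open CommutativeRing R
        open Eval R
    in (g : ℕ) → 1 ≤ g → (ns rs : Vec ℕ g) →
       (y y' : Fin g → ℕ → Carrier) →
       (∀ i j → j ≤ lookup ns i → y i j * y' i j ≈ 1#) →
       (x x' u v : Vec (List ℕ) g → Carrier) →
       (∀ e → e ∈ allP ns rs → T (inOpen ns rs e) →
          (x e * x' e ≈ 1#) × ((1# + - x e) * u e ≈ 1#) × ((1# + - x' e) * v e ≈ 1#)) →
       HLS ns rs y' (λ e → x' e * v e)
         ≈ sign (bigN ns rs) * (K ns rs y' * HLS ns rs y (λ e → x e * u e))
theorem3p14 R g _ ns rs y y' inverse x x' u v marks =
  HLS-reciprocity ns rs y y' inverse (λ e → x e * u e) (λ e → x' e * v e) inverted
  where
  open CommutativeRing R
  open Reciprocity R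
  inverted : ∀ e → e ∈ allP ns rs → inOpen ns rs e ≡ true → x' e * v e ≈ - (1# + x e * u e)
  inverted e e∈ e-open with marks e e∈ (≡.subst T (≡.sym e-open) _)
  ... | xx′≈1 , [1-x]u≈1 , [1-x′]v≈1 = inverted-mark xx′≈1 [1-x]u≈1 [1-x′]v≈1
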